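{- For $n\ge0$ let $b_n$ be the number of permutations $\pi$ of $\{1,\dots,n\}$ with $\#132(\pi)=1$ and $\#123(\pi)=2$. Then $$\sum_{n\ge0}b_nz^n=\frac{ -z^4(z^3-6z^2+4z-1)}{(1-2z)^4}.$$
   Context: For a permutation $\pi=\pi_1\cdots\pi_n$, $\#123(\pi)$ is the number of triples $i_1<i_2<i_3$ with $\pi_{i_1}<\pi_{i_2}<\pi_{i_3}$, and $\#132(\pi)$ is the number of triples $i_1<i_2<i_3$ with $\pi_{i_1}<\pi_{i_3}<\pi_{i_2}$. -}

module Defs where

open import Data.Bool using (Bool; true; false; _∧_; not; if_then_else_)
open import Data.Nat using (ℕ; zero; suc; _<ᵇ_; _≡ᵇ_; _∸_)
open import Data.Fin using (Fin; toℕ)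
open import Data.Vec using (Vec; []; _∷_; lookup)
open import Data.List using (List; []; _∷_; [_]; map; concatMap; allFin; filterᵇ; length; upTo)
open import Data.Nat.ListAction using (sum)
open import Data.Integer as ℤ using (ℤ; +_)

allVecs : (m k : ℕ) → List (Vec (Fin m) k)
allVecs m zero    = [ [] ]
allVecs m (suc k) = concatMap (λ x → map (x ∷_) (allVecs m k)) (allFin m)

countᵇ : ∀ {n} → (Fin n → Bool) → ℕ
countᵇ {n} p = length (filterᵇ p (allFin n))

_<F_ : ∀ {n} → Fin n → Fin n → Bool
i <F j = toℕ i <ᵇ toℕ j

-- A word π : Fin n → Fin n is a permutation of {1..n} (0-indexed) iff it is
-- injective: no pair i < j with π i = π j.
isPerm : ∀ {n} → Vec (Fin n) n → Bool
isPerm {n} π =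
  sum (map (λ i → countᵇ (λ j → (i <F j) ∧ (toℕ (lookup π i) ≡ᵇ toℕ (lookup π j)))) (allFin n)) ≡ᵇ 0

countTriples : ∀ {n} → (Fin n → Fin n → Fin n → Bool) → ℕ
countTriples p =
  sum (map (λ i → sum (map (λ j → countᵇ (λ k → (i <F j) ∧ (j <F k) ∧ p i j k))
    (allFin _))) (allFin _))

occ123 : ∀ {n} → Vec (Fin n) n → ℕ
occ123 π = countTriples (λ i j k → (lookup π i <F lookup π j) ∧ (lookup π j <F lookup π k))

occ132 : ∀ {n} → Vec (Fin n) n → ℕ
occ132 π = countTriples (λ i j k → (lookup π i <F lookup π k) ∧ (lookup π k <F lookup π j))

b : ℕ → ℕ
b n = length (filterᵇ (λ π → isPerm π ∧ (occ132 π ≡ᵇ 1) ∧ (occ123 π ≡ᵇ 2)) (allVecs n n))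

Series : Set
Series = ℕ → ℤ

-- polynomial given by its coefficient list (constant term first)
poly : List ℤ → Series
poly []       n       = + 0
poly (c ∷ cs) zero    = c
poly (c ∷ cs) (suc n) = poly cs n

_⊛_ : Series → Series → Series
(f ⊛ g) n = Data.List.foldr ℤ._+_ (+ 0) (map (λ k → f k ℤ.* g (n ∸ k)) (upTo (suc n)))

_^ˢ_ : Series → ℕ → Series
f ^ˢ zero  = poly (+ 1 ∷ [])
f ^ˢ suc k = f ⊛ (f ^ˢ k)

negˢ : Series → Series
negˢ f n = ℤ.- f n

B : Series
B n = + b n

{-# OPTIONS --safe #-}
-- A permutation of {0, …, m} is a first value x followed by a permutation σ of {0, …, m − 1} whose
-- values ≥ x are shifted up. The occurrences of 123 starting at x correspond to the ascending pairs of σ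
-- with smaller value ≥ x, those of 132 to the descending such pairs. If at least four values of σ are
-- ≥ x they form at least six pairs, forcing #123 ≥ 3 or #132 ≥ 2; otherwise the numbers of ascending
-- and descending pairs above the thresholds m − 1, m − 2, m − 3 are all that is needed to update the
-- pattern counts. So every permutation has one of finitely many profiles, on which prepending acts,
-- and the numbers v m of permutations of length m with each live profile satisfy v (m + 1) = T (v m)
-- for a fixed linear map T once m ≥ 3. A computation shows that (T − 2)⁴ kills v 6, hence every v m
-- with m ≥ 6; so the coefficients of (1 − 2z)⁴ ∑ bₙ zⁿ vanish from z¹⁰ on, and the lower ones follow
-- from the computed values b 0, …, b 9.
module Submission where

open import Defs
open import Data.Nat using (ℕ)
open import Data.List using (List; []; _∷_)
open import Data.Integer using (ℤ; +_; -_)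
open import Relation.Binary.PropositionalEquality using (_≡_)

open import Data.Bool using (Bool; true; false; _∧_; _∨_; not; if_then_else_; T)
import Data.Bool as Bool
open import Data.Bool.Properties
  using (∧-zeroʳ; ∧-identityʳ; ∧-assoc; ∧-conicalˡ; ∧-conicalʳ; ∧-distribˡ-∨; ∧-distribʳ-∨; not-involutive)
open import Data.Empty using (⊥; ⊥-elim)
open import Data.Fin using (Fin; toℕ) renaming (zero to fzero; suc to fsuc)
import Data.Integer as ℤ
import Data.Integer.Properties as ℤP
open import Data.Integer.Solver using (module +-*-Solver)
open import Data.List using (map; concat; concatMap; allFin; filterᵇ; length; _++_; upTo; applyUpTo; foldr)
import Data.List.Properties as List
open import Data.List.Relation.Unary.All using (All; []; _∷_; universal)
import Data.List.Relation.Unary.All as All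
open import Data.Nat using (zero; suc; _+_; _*_; _∸_; _⊓_; _<ᵇ_; _≡ᵇ_; _≤_; _<_; z≤n; s≤s)
import Data.Nat.Properties as ℕ
open import Algebra.Properties.CommutativeSemigroup ℕ.+-commutativeSemigroup using (interchange)
open import Data.Nat.ListAction using (sum)
open import Data.Product using (_×_; _,_)
open import Data.Sum using (inj₁; inj₂)
open import Data.Unit using (⊤; tt)
open import Data.Vec using (Vec; lookup) renaming (_∷_ to _∷ᵛ_)
open import Function using (_∘_)
open import Relation.Binary.PropositionalEquality using (refl; sym; trans; cong; cong₂; subst; module ≡-Reasoning)
open import Relation.Nullary using (Dec; yes; no)
open import Relation.Nullary.Decidable using (from-yes)

open ≡-Reasoning

bit : Bool → ℕ
bit true  = 1
bit false = 0

bit-∨ : ∀ a b → (a ∧ b) ≡ false → bit (a ∨ b) ≡ bit a + bit b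
bit-∨ true  false _ = refl
bit-∨ false b     _ = refl

+-≡ᵇ-0 : ∀ a b → (a + b ≡ᵇ 0) ≡ ((a ≡ᵇ 0) ∧ (b ≡ᵇ 0))
+-≡ᵇ-0 zero    b = refl
+-≡ᵇ-0 (suc a) b = refl

≡ᵇ-true⇒≡ : ∀ a b → (a ≡ᵇ b) ≡ true → a ≡ b
≡ᵇ-true⇒≡ a b h = ℕ.≡ᵇ⇒≡ a b (subst T (sym h) _)

<ᵇ-true⇒< : ∀ m n → (m <ᵇ n) ≡ true → m < n
<ᵇ-true⇒< m n h = ℕ.<ᵇ⇒< m n (subst T (sym h) _)

<ᵇ-weaken : ∀ a b → (a <ᵇ b) ≡ true → (a <ᵇ suc b) ≡ true
<ᵇ-weaken zero    b       _ = refl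
<ᵇ-weaken (suc a) (suc b) h = <ᵇ-weaken a b h

<ᵇ-+ˡ : ∀ k a b → (k + a <ᵇ b) ≡ true → (a <ᵇ b) ≡ true
<ᵇ-+ˡ zero    a b       h = h
<ᵇ-+ˡ (suc k) a (suc b) h = <ᵇ-weaken a b (<ᵇ-+ˡ k a b h)

-- Unlike the library's _≤ᵇ_, this recurses on both arguments, so that it computes under punchIn.
_≤ᵇ_ : ℕ → ℕ → Bool
zero  ≤ᵇ _     = true
suc a ≤ᵇ zero  = false
suc a ≤ᵇ suc b = a ≤ᵇ b

≤ᵇ⇒≤ : ∀ a b → (a ≤ᵇ b) ≡ true → a ≤ b
≤ᵇ⇒≤ zero    b       _ = z≤n
≤ᵇ⇒≤ (suc a) (suc b) h = s≤s (≤ᵇ⇒≤ a b h)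

≤⇒≤ᵇ : ∀ {a b} → a ≤ b → (a ≤ᵇ b) ≡ true
≤⇒≤ᵇ z≤n     = refl
≤⇒≤ᵇ (s≤s h) = ≤⇒≤ᵇ h

>⇒≤ᵇ-false : ∀ {a b} → b < a → (a ≤ᵇ b) ≡ false
>⇒≤ᵇ-false {suc a} {zero}  _       = refl
>⇒≤ᵇ-false {suc a} {suc b} (s≤s h) = >⇒≤ᵇ-false h

≤ᵇ-false⇒> : ∀ a b → (a ≤ᵇ b) ≡ false → b < a
≤ᵇ-false⇒> (suc a) zero    _ = s≤s z≤n
≤ᵇ-false⇒> (suc a) (suc b) h = s≤s (≤ᵇ-false⇒> a b h)

bit-<ᵇ-+-≤ᵇ : ∀ a b → bit (a <ᵇ b) + bit (b ≤ᵇ a) ≡ 1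
bit-<ᵇ-+-≤ᵇ a       zero    = refl
bit-<ᵇ-+-≤ᵇ zero    (suc b) = refl
bit-<ᵇ-+-≤ᵇ (suc a) (suc b) = bit-<ᵇ-+-≤ᵇ a b

bit-<ᵇ-+-<ᵇ : ∀ a b → (a ≡ᵇ b) ≡ false → bit (a <ᵇ b) + bit (b <ᵇ a) ≡ 1
bit-<ᵇ-+-<ᵇ zero    (suc b) _ = refl
bit-<ᵇ-+-<ᵇ (suc a) zero    _ = refl
bit-<ᵇ-+-<ᵇ (suc a) (suc b) h = bit-<ᵇ-+-<ᵇ a b h

m∸[m∸n]≡n⊓m : ∀ m n → m ∸ (m ∸ n) ≡ n ⊓ m
m∸[m∸n]≡n⊓m zero    zero    = refl
m∸[m∸n]≡n⊓m zero    (suc n) = refl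
m∸[m∸n]≡n⊓m (suc m) zero    = ℕ.n∸n≡0 (suc m)
m∸[m∸n]≡n⊓m (suc m) (suc n) = trans (ℕ.+-∸-assoc 1 (ℕ.m∸n≤m m n)) (cong suc (m∸[m∸n]≡n⊓m m n))

m∸n≤o⇒m∸o≤n : ∀ {m n o} → n ≤ m → m ∸ n ≤ o → m ∸ o ≤ n
m∸n≤o⇒m∸o≤n {m} {n} {o} n≤m m∸n≤o = subst (m ∸ o ≤_) (ℕ.m∸[m∸n]≡n n≤m) (ℕ.∸-monoʳ-≤ m m∸n≤o)

o<m∸n⇒n≤m∸suc[o] : ∀ {m n o} → n ≤ m → o < m ∸ n → n ≤ m ∸ suc o
o<m∸n⇒n≤m∸suc[o] {m} {n} {o} n≤m o<m∸n = subst (_≤ m ∸ suc o) (ℕ.m∸[m∸n]≡n n≤m) (ℕ.∸-monoʳ-≤ m o<m∸n)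

n≤o⇒n⊓m≡n⊓[m⊓o] : ∀ {n o} m → n ≤ o → n ⊓ m ≡ n ⊓ (m ⊓ o)
n≤o⇒n⊓m≡n⊓[m⊓o] {n} {o} m n≤o = begin
  n ⊓ m          ≡⟨ cong (_⊓ m) (ℕ.m≤n⇒m⊓n≡m n≤o) ⟨
  (n ⊓ o) ⊓ m    ≡⟨ ℕ.⊓-assoc n o m ⟩
  n ⊓ (o ⊓ m)    ≡⟨ cong (n ⊓_) (ℕ.⊓-comm o m) ⟩
  n ⊓ (m ⊓ o)    ∎

count : {A : Set} → (A → Bool) → List A → ℕ
count p []      = 0
count p (v ∷ l) = bit (p v) + count p l

module _ {A : Set} where

  length-filterᵇ : (p : A → Bool) (l : List A) → length (filterᵇ p l) ≡ count p l
  length-filterᵇ p []      = refl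
  length-filterᵇ p (v ∷ l) with p v
  ... | true  = cong suc (length-filterᵇ p l)
  ... | false = length-filterᵇ p l

  count-map : {B : Set} (p : B → Bool) (f : A → B) (l : List A) → count p (map f l) ≡ count (p ∘ f) l
  count-map p f []      = refl
  count-map p f (v ∷ l) = cong (_+_ (bit (p (f v)))) (count-map p f l)

  count-cong : {p q : A → Bool} → (∀ v → p v ≡ q v) → (l : List A) → count p l ≡ count q l
  count-cong h []      = refl
  count-cong h (v ∷ l) = cong₂ _+_ (cong bit (h v)) (count-cong h l)

  count-false : (l : List A) → count (λ _ → false) l ≡ 0
  count-false []      = refl
  count-false (v ∷ l) = count-false l

  count-++ : (p : A → Bool) (l r : List A) → count p (l ++ r) ≡ count p l + count p r
  count-++ p []      r = refl
  count-++ p (v ∷ l) r = trans (cong (_+_ (bit (p v))) (count-++ p l r)) (sym (ℕ.+-assoc (bit (p v)) _ _))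

  count-concat : (p : A → Bool) (ls : List (List A)) → count p (concat ls) ≡ sum (map (count p) ls)
  count-concat p []       = refl
  count-concat p (l ∷ ls) = trans (count-++ p l (concat ls)) (cong (_+_ (count p l)) (count-concat p ls))

  count-+ : (p q r : A → Bool) {l : List A} →
            All (λ v → bit (p v) + bit (q v) ≡ bit (r v)) l → count p l + count q l ≡ count r l
  count-+ p q r []                 = refl
  count-+ p q r {v ∷ l} (pqr ∷ hs) = begin
    (bit (p v) + count p l) + (bit (q v) + count q l) ≡⟨ interchange (bit (p v)) _ _ _ ⟩
    (bit (p v) + bit (q v)) + (count p l + count q l) ≡⟨ cong₂ _+_ pqr (count-+ p q r hs) ⟩
    bit (r v) + count r l                             ∎

∑< : ℕ → (ℕ → ℕ) → ℕ
∑< n f = sum (applyUpTo f n)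

∑<-cong : ∀ n {f g : ℕ → ℕ} → (∀ i → i < n → f i ≡ g i) → ∑< n f ≡ ∑< n g
∑<-cong zero    h = refl
∑<-cong (suc n) h = cong₂ _+_ (h 0 (s≤s z≤n)) (∑<-cong n (λ i i<n → h (suc i) (s≤s i<n)))

∑<-zero : ∀ n → ∑< n (λ _ → 0) ≡ 0
∑<-zero zero    = refl
∑<-zero (suc n) = ∑<-zero n

∑<-+ : ∀ n (f g : ℕ → ℕ) → ∑< n (λ i → f i + g i) ≡ ∑< n f + ∑< n g
∑<-+ zero    f g = refl
∑<-+ (suc n) f g = trans (cong (_+_ (f 0 + g 0)) (∑<-+ n (f ∘ suc) (g ∘ suc))) (interchange (f 0) (g 0) _ _)

∑<-* : ∀ n c (f : ℕ → ℕ) → ∑< n (λ i → c * f i) ≡ c * ∑< n f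
∑<-* zero    c f = sym (ℕ.*-zeroʳ c)
∑<-* (suc n) c f = trans (cong (_+_ (c * f 0)) (∑<-* n c (f ∘ suc))) (sym (ℕ.*-distribˡ-+ c (f 0) _))

∑<-suc : ∀ n (f : ℕ → ℕ) → ∑< (suc n) f ≡ ∑< n f + f n
∑<-suc zero    f = ℕ.+-comm (f 0) 0
∑<-suc (suc n) f = trans (cong (_+_ (f 0)) (∑<-suc n (f ∘ suc))) (sym (ℕ.+-assoc (f 0) _ _))

∑<-reverse : ∀ n (f : ℕ → ℕ) → ∑< n (λ i → f (n ∸ suc i)) ≡ ∑< n f
∑<-reverse zero    f = refl
∑<-reverse (suc n) f = begin
  f n + ∑< n (λ i → f (n ∸ suc i)) ≡⟨ cong (_+_ (f n)) (∑<-reverse n f) ⟩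
  f n + ∑< n f                     ≡⟨ ℕ.+-comm (f n) _ ⟩
  ∑< n f + f n                     ≡⟨ ∑<-suc n f ⟨
  ∑< (suc n) f                     ∎

∑<-⊓ : ∀ b n (f : ℕ → ℕ) → (∀ i → f (b + i) ≡ 0) → ∑< n f ≡ ∑< (n ⊓ b) f
∑<-⊓ zero    zero    f h = refl
∑<-⊓ zero    (suc n) f h = trans (∑<-cong (suc n) (λ i _ → h i)) (∑<-zero (suc n))
∑<-⊓ (suc b) zero    f h = refl
∑<-⊓ (suc b) (suc n) f h = cong (_+_ (f 0)) (∑<-⊓ b n (f ∘ suc) h)

module _ {k : ℕ} where

  allFin-suc : allFin (suc k) ≡ fzero ∷ map fsuc (allFin k)
  allFin-suc = cong (fzero ∷_) (sym (List.map-tabulate (λ i → i) fsuc))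

  map-allFin-suc : {A : Set} (f : Fin (suc k) → A) → map f (allFin (suc k)) ≡ f fzero ∷ map (f ∘ fsuc) (allFin k)
  map-allFin-suc f = trans (cong (map f) allFin-suc) (cong (f fzero ∷_) (sym (List.map-∘ (allFin k))))

  sum-allFin-suc : (f : Fin (suc k) → ℕ) → sum (map f (allFin (suc k))) ≡ f fzero + sum (map (f ∘ fsuc) (allFin k))
  sum-allFin-suc f = cong sum (map-allFin-suc f)

  sum-allFin-cong : {f g : Fin k → ℕ} → (∀ i → f i ≡ g i) → sum (map f (allFin k)) ≡ sum (map g (allFin k))
  sum-allFin-cong h = cong sum (List.map-cong h (allFin k))

  countᵇ-map : (p : ℕ → Bool) (g : Fin k → ℕ) → countᵇ (p ∘ g) ≡ count p (map g (allFin k))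
  countᵇ-map p g = trans (length-filterᵇ (p ∘ g) (allFin k)) (sym (count-map p g (allFin k)))

  countᵇ-false : countᵇ {k} (λ _ → false) ≡ 0
  countᵇ-false = trans (length-filterᵇ _ (allFin k)) (count-false (allFin k))

countᵇ-suc : ∀ {k} (p : Fin (suc k) → Bool) → countᵇ p ≡ bit (p fzero) + countᵇ (p ∘ fsuc)
countᵇ-suc {k} p = begin
  countᵇ p                                          ≡⟨ length-filterᵇ p (allFin (suc k)) ⟩
  count p (allFin (suc k))                          ≡⟨ cong (count p) allFin-suc ⟩
  bit (p fzero) + count p (map fsuc (allFin k))     ≡⟨ cong (_+_ (bit (p fzero))) (count-map p fsuc (allFin k)) ⟩
  bit (p fzero) + count (p ∘ fsuc) (allFin k)       ≡⟨ cong (_+_ (bit (p fzero))) (sym (length-filterᵇ (p ∘ fsuc) (allFin k))) ⟩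
  bit (p fzero) + countᵇ (p ∘ fsuc)                 ∎

countᵇ-after-suc : ∀ {k} (b : Bool) (j : Fin k) (p : Fin (suc k) → Bool) →
                   countᵇ (λ l → b ∧ (fsuc j <F l) ∧ p l) ≡ countᵇ (λ l → b ∧ (j <F l) ∧ p (fsuc l))
countᵇ-after-suc b j p = trans (countᵇ-suc (λ l → b ∧ (fsuc j <F l) ∧ p l))
                                 (cong (λ c → bit c + countᵇ (λ l → b ∧ (j <F l) ∧ p (fsuc l))) (∧-zeroʳ b))

sum-allFin-toℕ : ∀ m (f : ℕ → ℕ) → sum (map (f ∘ toℕ) (allFin m)) ≡ ∑< m f
sum-allFin-toℕ zero    f = refl
sum-allFin-toℕ (suc m) f = trans (sum-allFin-suc {m} (f ∘ toℕ)) (cong (_+_ (f 0)) (sum-allFin-toℕ m (f ∘ suc)))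

pairCount : (ℕ → ℕ → Bool) → List ℕ → ℕ
pairCount q []      = 0
pairCount q (v ∷ l) = count (q v) l + pairCount q l

tripleCount : (ℕ → ℕ → ℕ → Bool) → List ℕ → ℕ
tripleCount q []      = 0
tripleCount q (v ∷ l) = pairCount (q v) l + tripleCount q l

sum-countᵇ-pairs : ∀ {k} (r : ℕ → ℕ → Bool) (g : Fin k → ℕ) →
  sum (map (λ i → countᵇ (λ j → (i <F j) ∧ r (g i) (g j))) (allFin k)) ≡ pairCount r (map g (allFin k))
sum-countᵇ-pairs {zero}  r g = refl
sum-countᵇ-pairs {suc k} r g = begin
  sum (map row (allFin (suc k)))                                         ≡⟨ sum-allFin-suc row ⟩
  row fzero + sum (map (row ∘ fsuc) (allFin k))                          ≡⟨ cong₂ _+_ first rest ⟩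
  count (r (g fzero)) (map (g ∘ fsuc) (allFin k)) + pairCount r (map (g ∘ fsuc) (allFin k))
                                                                         ≡⟨ cong (pairCount r) (sym (map-allFin-suc g)) ⟩
  pairCount r (map g (allFin (suc k)))                                   ∎
  where
  row : Fin (suc k) → ℕ
  row i = countᵇ (λ j → (i <F j) ∧ r (g i) (g j))
  first : row fzero ≡ count (r (g fzero)) (map (g ∘ fsuc) (allFin k))
  first = trans (countᵇ-suc (λ j → (fzero <F j) ∧ r (g fzero) (g j))) (countᵇ-map (r (g fzero)) (g ∘ fsuc))
  rest : sum (map (row ∘ fsuc) (allFin k)) ≡ pairCount r (map (g ∘ fsuc) (allFin k))
  rest = trans (sum-allFin-cong (λ i → countᵇ-suc (λ j → (fsuc i <F j) ∧ r (g (fsuc i)) (g j))))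
                (sum-countᵇ-pairs r (g ∘ fsuc))

countTriples-map : ∀ {k} (q : ℕ → ℕ → ℕ → Bool) (g : Fin k → ℕ) →
  countTriples (λ i j l → q (g i) (g j) (g l)) ≡ tripleCount q (map g (allFin k))
countTriples-map {zero}  q g = refl
countTriples-map {suc k} q g = begin
  sum (map row (allFin (suc k)))                                         ≡⟨ sum-allFin-suc row ⟩
  row fzero + sum (map (row ∘ fsuc) (allFin k))                          ≡⟨ cong₂ _+_ first rest ⟩
  pairCount (q (g fzero)) (map (g ∘ fsuc) (allFin k)) + tripleCount q (map (g ∘ fsuc) (allFin k))
                                                                         ≡⟨ cong (tripleCount q) (sym (map-allFin-suc g)) ⟩
  tripleCount q (map g (allFin (suc k)))                                 ∎
  where
  cell : Fin (suc k) → Fin (suc k) → ℕ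
  cell i j = countᵇ (λ l → (i <F j) ∧ (j <F l) ∧ q (g i) (g j) (g l))
  row : Fin (suc k) → ℕ
  row i = sum (map (cell i) (allFin (suc k)))
  row-suc : ∀ i → row i
          ≡ sum (map (λ j → countᵇ (λ l → (i <F fsuc j) ∧ (j <F l) ∧ q (g i) (g (fsuc j)) (g (fsuc l)))) (allFin k))
  row-suc i = trans (sum-allFin-suc (cell i)) (cong₂ _+_ (countᵇ-false {suc k})
                (sum-allFin-cong (λ j → countᵇ-after-suc (i <F fsuc j) j (λ l → q (g i) (g (fsuc j)) (g l)))))
  first : row fzero ≡ pairCount (q (g fzero)) (map (g ∘ fsuc) (allFin k))
  first = trans (row-suc fzero) (sum-countᵇ-pairs (q (g fzero)) (g ∘ fsuc))
  rest : sum (map (row ∘ fsuc) (allFin k)) ≡ tripleCount q (map (g ∘ fsuc) (allFin k))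
  rest = trans (sum-allFin-cong (λ i → row-suc (fsuc i))) (countTriples-map q (g ∘ fsuc))

pairCount-map : ∀ (q : ℕ → ℕ → Bool) (f : ℕ → ℕ) l → pairCount q (map f l) ≡ pairCount (λ a b → q (f a) (f b)) l
pairCount-map q f []      = refl
pairCount-map q f (v ∷ l) = cong₂ _+_ (count-map (q (f v)) f l) (pairCount-map q f l)

pairCount-cong : ∀ {q r : ℕ → ℕ → Bool} → (∀ a b → q a b ≡ r a b) → ∀ l → pairCount q l ≡ pairCount r l
pairCount-cong h []      = refl
pairCount-cong h (v ∷ l) = cong₂ _+_ (count-cong (h v) l) (pairCount-cong h l)

tripleCount-map : ∀ (q : ℕ → ℕ → ℕ → Bool) (f : ℕ → ℕ) l →
                  tripleCount q (map f l) ≡ tripleCount (λ a b c → q (f a) (f b) (f c)) l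
tripleCount-map q f []      = refl
tripleCount-map q f (v ∷ l) = cong₂ _+_ (pairCount-map (q (f v)) f l) (tripleCount-map q f l)

tripleCount-cong : ∀ {q r : ℕ → ℕ → ℕ → Bool} → (∀ a b c → q a b c ≡ r a b c) →
                   ∀ l → tripleCount q l ≡ tripleCount r l
tripleCount-cong h []      = refl
tripleCount-cong h (v ∷ l) = cong₂ _+_ (pairCount-cong (h v) l) (tripleCount-cong h l)

is123 is132 : ℕ → ℕ → ℕ → Bool
is123 a b c = (a <ᵇ b) ∧ (b <ᵇ c)
is132 a b c = (a <ᵇ c) ∧ (c <ᵇ b)

#123 #132 : List ℕ → ℕ
#123 = tripleCount is123
#132 = tripleCount is132

word : ∀ {m k} → Vec (Fin m) k → List ℕ
word {k = k} π = map (λ i → toℕ (lookup π i)) (allFin k)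

wordCount : ℕ → ℕ → (List ℕ → Bool) → ℕ
wordCount m zero    p = bit (p [])
wordCount m (suc k) p = ∑< m (λ y → wordCount m k (p ∘ (y ∷_)))

count-allVecs : ∀ m k (p : List ℕ → Bool) → count (p ∘ word) (allVecs m k) ≡ wordCount m k p
count-allVecs m zero    p = ℕ.+-identityʳ (bit (p []))
count-allVecs m (suc k) p = begin
  count (p ∘ word) (concat (map extend (allFin m)))
    ≡⟨ count-concat (p ∘ word) (map extend (allFin m)) ⟩
  sum (map (count (p ∘ word)) (map extend (allFin m)))
    ≡⟨ cong sum (List.map-∘ (allFin m)) ⟨
  sum (map (count (p ∘ word) ∘ extend) (allFin m))
    ≡⟨ sum-allFin-cong byFirstLetter ⟩
  sum (map (λ x → wordCount m k (p ∘ (toℕ x ∷_))) (allFin m))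
    ≡⟨ sum-allFin-toℕ m (λ y → wordCount m k (p ∘ (y ∷_))) ⟩
  wordCount m (suc k) p ∎
  where
  extend : Fin m → List (Vec (Fin m) (suc k))
  extend x = map (x ∷ᵛ_) (allVecs m k)
  byFirstLetter : ∀ x → count (p ∘ word) (extend x) ≡ wordCount m k (p ∘ (toℕ x ∷_))
  byFirstLetter x = begin
    count (p ∘ word) (extend x)                    ≡⟨ count-map (p ∘ word) (x ∷ᵛ_) (allVecs m k) ⟩
    count (λ π → p (word (x ∷ᵛ π))) (allVecs m k) ≡⟨ count-cong (λ π → cong p (map-allFin-suc _)) (allVecs m k) ⟩
    count ((p ∘ (toℕ x ∷_)) ∘ word) (allVecs m k)  ≡⟨ count-allVecs m k (p ∘ (toℕ x ∷_)) ⟩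
    wordCount m k (p ∘ (toℕ x ∷_))                 ∎

wordCount-cong : ∀ m k {p q : List ℕ → Bool} → (∀ w → p w ≡ q w) → wordCount m k p ≡ wordCount m k q
wordCount-cong m zero    h = cong bit (h [])
wordCount-cong m (suc k) h = ∑<-cong m (λ y _ → wordCount-cong m k (λ w → h (y ∷ w)))

wordCount-false : ∀ m k → wordCount m k (λ _ → false) ≡ 0
wordCount-false m zero    = refl
wordCount-false m (suc k) = trans (∑<-cong m (λ y _ → wordCount-false m k)) (∑<-zero m)

wordCount-∨ : ∀ m k (p q : List ℕ → Bool) → (∀ w → (p w ∧ q w) ≡ false) →
              wordCount m k (λ w → p w ∨ q w) ≡ wordCount m k p + wordCount m k q
wordCount-∨ m zero    p q h = bit-∨ (p []) (q []) (h [])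
wordCount-∨ m (suc k) p q h =
  trans (∑<-cong m (λ y _ → wordCount-∨ m k (p ∘ (y ∷_)) (q ∘ (y ∷_)) (h ∘ (y ∷_)))) (∑<-+ m _ _)

punchIn : ℕ → ℕ → ℕ
punchIn zero    a       = suc a
punchIn (suc x) zero    = zero
punchIn (suc x) (suc a) = suc (punchIn x a)

prepend : ℕ → List ℕ → List ℕ
prepend x σ = x ∷ map (punchIn x) σ

notIn : ℕ → List ℕ → Bool
notIn x []      = true
notIn x (y ∷ l) = not (x ≡ᵇ y) ∧ notIn x l

distinct : List ℕ → Bool
distinct []      = true
distinct (y ∷ l) = notIn y l ∧ distinct l

count-≡ᵇ-0 : ∀ v l → (count (v ≡ᵇ_) l ≡ᵇ 0) ≡ notIn v l
count-≡ᵇ-0 v []      = refl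
count-≡ᵇ-0 v (y ∷ l) with v ≡ᵇ y
... | true  = refl
... | false = count-≡ᵇ-0 v l

pairCount-≡ᵇ-0 : ∀ l → (pairCount _≡ᵇ_ l ≡ᵇ 0) ≡ distinct l
pairCount-≡ᵇ-0 []      = refl
pairCount-≡ᵇ-0 (v ∷ l) =
  trans (+-≡ᵇ-0 (count (v ≡ᵇ_) l) (pairCount _≡ᵇ_ l)) (cong₂ _∧_ (count-≡ᵇ-0 v l) (pairCount-≡ᵇ-0 l))

punchIn-≡ᵇ : ∀ x a b → (punchIn x a ≡ᵇ punchIn x b) ≡ (a ≡ᵇ b)
punchIn-≡ᵇ zero    a       b       = refl
punchIn-≡ᵇ (suc x) zero    zero    = refl
punchIn-≡ᵇ (suc x) zero    (suc b) = refl
punchIn-≡ᵇ (suc x) (suc a) zero    = refl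
punchIn-≡ᵇ (suc x) (suc a) (suc b) = punchIn-≡ᵇ x a b

≡ᵇ-punchIn : ∀ x a → (x ≡ᵇ punchIn x a) ≡ false
≡ᵇ-punchIn zero    a       = refl
≡ᵇ-punchIn (suc x) zero    = refl
≡ᵇ-punchIn (suc x) (suc a) = ≡ᵇ-punchIn x a

notIn-map-punchIn : ∀ x a l → notIn (punchIn x a) (map (punchIn x) l) ≡ notIn a l
notIn-map-punchIn x a []      = refl
notIn-map-punchIn x a (y ∷ l) = cong₂ (λ u v → not u ∧ v) (punchIn-≡ᵇ x a y) (notIn-map-punchIn x a l)

notIn-punchIn : ∀ x l → notIn x (map (punchIn x) l) ≡ true
notIn-punchIn x []      = refl
notIn-punchIn x (y ∷ l) rewrite ≡ᵇ-punchIn x y = notIn-punchIn x l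

distinct-map-punchIn : ∀ x l → distinct (map (punchIn x) l) ≡ distinct l
distinct-map-punchIn x []      = refl
distinct-map-punchIn x (y ∷ l) = cong₂ _∧_ (notIn-map-punchIn x y l) (distinct-map-punchIn x l)

∑<-punchIn : ∀ x m → x ≤ m → (g : ℕ → ℕ) →
             ∑< (suc m) (λ y → if x ≡ᵇ y then 0 else g y) ≡ ∑< m (g ∘ punchIn x)
∑<-punchIn zero    m       _         g = refl
∑<-punchIn (suc x) (suc m) (s≤s x≤m) g = cong (_+_ (g 0)) (∑<-punchIn x m x≤m (g ∘ suc))

wordCount-notIn : ∀ m k x → x ≤ m → (R : List ℕ → Bool) →
                  wordCount (suc m) k (λ w → notIn x w ∧ R w) ≡ wordCount m k (R ∘ map (punchIn x))
wordCount-notIn m zero    x x≤m R = refl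
wordCount-notIn m (suc k) x x≤m R =
  trans (∑<-cong (suc m) (λ y _ → byFirstLetter y))
        (∑<-punchIn x m x≤m (λ y → wordCount m k (λ σ → R (y ∷ map (punchIn x) σ))))
  where
  byFirstLetter : ∀ y → wordCount (suc m) k (λ w → (not (x ≡ᵇ y) ∧ notIn x w) ∧ R (y ∷ w))
                      ≡ (if x ≡ᵇ y then 0 else wordCount m k (λ σ → R (y ∷ map (punchIn x) σ)))
  byFirstLetter y with x ≡ᵇ y
  ... | true  = wordCount-false (suc m) k
  ... | false = wordCount-notIn m k x x≤m (R ∘ (y ∷_))

permCount : (List ℕ → Bool) → ℕ → ℕ
permCount P m = wordCount m m (λ w → distinct w ∧ P w)

permCount-suc : ∀ m (P : List ℕ → Bool) → permCount P (suc m) ≡ ∑< (suc m) (λ x → permCount (P ∘ prepend x) m)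
permCount-suc m P = ∑<-cong (suc m) (λ x x≤m → begin
  wordCount (suc m) m (λ w → (notIn x w ∧ distinct w) ∧ P (x ∷ w))
    ≡⟨ wordCount-cong (suc m) m (λ w → ∧-assoc (notIn x w) _ _) ⟩
  wordCount (suc m) m (λ w → notIn x w ∧ (distinct w ∧ P (x ∷ w)))
    ≡⟨ wordCount-notIn m m x (ℕ.≤-pred x≤m) _ ⟩
  wordCount m m (λ σ → distinct (map (punchIn x) σ) ∧ P (prepend x σ))
    ≡⟨ wordCount-cong m m (λ σ → cong (_∧ P (prepend x σ)) (distinct-map-punchIn x σ)) ⟩
  permCount (P ∘ prepend x) m ∎)

data Perm : ℕ → List ℕ → Set where
  []   : Perm 0 []
  cons : ∀ {m σ x} → x ≤ m → Perm m σ → Perm (suc m) (prepend x σ)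

permCount-cong : ∀ m {P Q : List ℕ → Bool} → (∀ {σ} → Perm m σ → P σ ≡ Q σ) → permCount P m ≡ permCount Q m
permCount-cong zero    h = cong bit (h [])
permCount-cong (suc m) {P} {Q} h = begin
  permCount P (suc m)                             ≡⟨ permCount-suc m P ⟩
  ∑< (suc m) (λ x → permCount (P ∘ prepend x) m)
    ≡⟨ ∑<-cong (suc m) (λ x x≤m → permCount-cong m (h ∘ cons (ℕ.≤-pred x≤m))) ⟩
  ∑< (suc m) (λ x → permCount (Q ∘ prepend x) m) ≡⟨ permCount-suc m Q ⟨
  permCount Q (suc m)                             ∎

permCount-never : ∀ m → permCount (λ _ → false) m ≡ 0
permCount-never m = trans (wordCount-cong m m (λ w → ∧-zeroʳ (distinct w))) (wordCount-false m m)

permCount-false : ∀ m {P : List ℕ → Bool} → (∀ {σ} → Perm m σ → P σ ≡ false) → permCount P m ≡ 0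
permCount-false m h = trans (permCount-cong m h) (permCount-never m)

permCount-≗ : ∀ m {P Q : List ℕ → Bool} → (∀ σ → P σ ≡ Q σ) → permCount P m ≡ permCount Q m
permCount-≗ m h = permCount-cong m (λ {σ} _ → h σ)

permCount-∨ : ∀ m (P Q : List ℕ → Bool) → (∀ σ → (P σ ∧ Q σ) ≡ false) →
              permCount (λ σ → P σ ∨ Q σ) m ≡ permCount P m + permCount Q m
permCount-∨ m P Q disjoint = trans (wordCount-cong m m distrib) (wordCount-∨ m m _ _ disjoint′)
  where
  distrib : ∀ w → (distinct w ∧ (P w ∨ Q w)) ≡ ((distinct w ∧ P w) ∨ (distinct w ∧ Q w))
  distrib w = ∧-distribˡ-∨ (distinct w) (P w) (Q w)
  disjoint′ : ∀ w → ((distinct w ∧ P w) ∧ (distinct w ∧ Q w)) ≡ false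
  disjoint′ w with distinct w
  ... | true  = disjoint w
  ... | false = refl

Perm⇒distinct : ∀ {m σ} → Perm m σ → distinct σ ≡ true
Perm⇒distinct []                    = refl
Perm⇒distinct (cons {σ = σ} {x} _ r) rewrite notIn-punchIn x σ | distinct-map-punchIn x σ = Perm⇒distinct r

-- Pairs above a threshold

<ᵇ-punchIn : ∀ x a → (x <ᵇ punchIn x a) ≡ (x ≤ᵇ a)
<ᵇ-punchIn zero    a       = refl
<ᵇ-punchIn (suc x) zero    = refl
<ᵇ-punchIn (suc x) (suc a) = <ᵇ-punchIn x a

punchIn-<ᵇ : ∀ x a b → (punchIn x a <ᵇ punchIn x b) ≡ (a <ᵇ b)
punchIn-<ᵇ zero    a       b       = refl
punchIn-<ᵇ (suc x) zero    zero    = refl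
punchIn-<ᵇ (suc x) zero    (suc b) = refl
punchIn-<ᵇ (suc x) (suc a) zero    = refl
punchIn-<ᵇ (suc x) (suc a) (suc b) = punchIn-<ᵇ x a b

punchIn-<ᵇ-self : ∀ x a → (punchIn x a <ᵇ x) ≡ (a <ᵇ x)
punchIn-<ᵇ-self zero    a       = refl
punchIn-<ᵇ-self (suc x) zero    = refl
punchIn-<ᵇ-self (suc x) (suc a) = punchIn-<ᵇ-self x a

≤ᵇ-punchIn-≤ : ∀ {θ x} a → θ ≤ x → (θ ≤ᵇ punchIn x a) ≡ (θ ≤ᵇ a)
≤ᵇ-punchIn-≤ a       z≤n     = refl
≤ᵇ-punchIn-≤ zero    (s≤s h) = refl
≤ᵇ-punchIn-≤ (suc a) (s≤s h) = ≤ᵇ-punchIn-≤ a h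

≤ᵇ-punchIn-≥ : ∀ {θ x} a → x ≤ θ → (suc θ ≤ᵇ punchIn x a) ≡ (θ ≤ᵇ a)
≤ᵇ-punchIn-≥ a       z≤n     = refl
≤ᵇ-punchIn-≥ zero    (s≤s h) = refl
≤ᵇ-punchIn-≥ (suc a) (s≤s h) = ≤ᵇ-punchIn-≥ a h

≤ᵇ-∧-<ᵇ-≥ : ∀ {θ x} a → x ≤ θ → ((θ ≤ᵇ a) ∧ (a <ᵇ x)) ≡ false
≤ᵇ-∧-<ᵇ-≥ {θ} a       z≤n     = ∧-zeroʳ (θ ≤ᵇ a)
≤ᵇ-∧-<ᵇ-≥     zero    (s≤s h) = refl
≤ᵇ-∧-<ᵇ-≥     (suc a) (s≤s h) = ≤ᵇ-∧-<ᵇ-≥ a h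

ascAbove descAbove : ℕ → List ℕ → ℕ
ascAbove  θ = pairCount (λ a b → (θ ≤ᵇ a) ∧ (a <ᵇ b))
descAbove θ = pairCount (λ a b → (θ ≤ᵇ b) ∧ (b <ᵇ a))

topAsc topDesc : ℕ → List ℕ → ℕ → ℕ
topAsc  m σ i = ascAbove (m ∸ i) σ
topDesc m σ i = descAbove (m ∸ i) σ

#123-prepend : ∀ x σ → #123 (prepend x σ) ≡ ascAbove x σ + #123 σ
#123-prepend x σ = cong₂ _+_
  (trans (pairCount-map (is123 x) (punchIn x) σ) (pairCount-cong (λ a b → cong₂ _∧_ (<ᵇ-punchIn x a) (punchIn-<ᵇ x a b)) σ))
  (trans (tripleCount-map is123 (punchIn x) σ)
         (tripleCount-cong (λ a b c → cong₂ _∧_ (punchIn-<ᵇ x a b) (punchIn-<ᵇ x b c)) σ))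

#132-prepend : ∀ x σ → #132 (prepend x σ) ≡ descAbove x σ + #132 σ
#132-prepend x σ = cong₂ _+_
  (trans (pairCount-map (is132 x) (punchIn x) σ) (pairCount-cong (λ a b → cong₂ _∧_ (<ᵇ-punchIn x b) (punchIn-<ᵇ x b a)) σ))
  (trans (tripleCount-map is132 (punchIn x) σ)
         (tripleCount-cong (λ a b c → cong₂ _∧_ (punchIn-<ᵇ x a c) (punchIn-<ᵇ x c b)) σ))

ascAbove-prepend-≤ : ∀ {θ x} σ → θ ≤ x → ascAbove θ (prepend x σ) ≡ count (x ≤ᵇ_) σ + ascAbove θ σ
ascAbove-prepend-≤ {θ} {x} σ θ≤x rewrite ≤⇒≤ᵇ θ≤x = cong₂ _+_
  (trans (count-map (x <ᵇ_) (punchIn x) σ) (count-cong (<ᵇ-punchIn x) σ))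
  (trans (pairCount-map _ (punchIn x) σ) (pairCount-cong (λ a b → cong₂ _∧_ (≤ᵇ-punchIn-≤ a θ≤x) (punchIn-<ᵇ x a b)) σ))

ascAbove-prepend-≥ : ∀ {θ x} σ → x ≤ θ → ascAbove (suc θ) (prepend x σ) ≡ ascAbove θ σ
ascAbove-prepend-≥ {θ} {x} σ x≤θ rewrite >⇒≤ᵇ-false (s≤s x≤θ) = cong₂ _+_
  (count-false (map (punchIn x) σ))
  (trans (pairCount-map _ (punchIn x) σ) (pairCount-cong (λ a b → cong₂ _∧_ (≤ᵇ-punchIn-≥ a x≤θ) (punchIn-<ᵇ x a b)) σ))

descAbove-prepend-≤ : ∀ {θ x} σ → θ ≤ x →
                      descAbove θ (prepend x σ) ≡ count (λ b → (θ ≤ᵇ b) ∧ (b <ᵇ x)) σ + descAbove θ σ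
descAbove-prepend-≤ {θ} {x} σ θ≤x = cong₂ _+_
  (trans (count-map _ (punchIn x) σ) (count-cong (λ a → cong₂ _∧_ (≤ᵇ-punchIn-≤ a θ≤x) (punchIn-<ᵇ-self x a)) σ))
  (trans (pairCount-map _ (punchIn x) σ) (pairCount-cong (λ a b → cong₂ _∧_ (≤ᵇ-punchIn-≤ b θ≤x) (punchIn-<ᵇ x b a)) σ))

descAbove-prepend-≥ : ∀ {θ x} σ → x ≤ θ → descAbove (suc θ) (prepend x σ) ≡ descAbove θ σ
descAbove-prepend-≥ {θ} {x} σ x≤θ = cong₂ _+_
  (trans (count-map _ (punchIn x) σ)
         (trans (count-cong (λ a → trans (cong₂ _∧_ (≤ᵇ-punchIn-≥ a x≤θ) (punchIn-<ᵇ-self x a))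
                                         (≤ᵇ-∧-<ᵇ-≥ a x≤θ)) σ)
                (count-false σ)))
  (trans (pairCount-map _ (punchIn x) σ) (pairCount-cong (λ a b → cong₂ _∧_ (≤ᵇ-punchIn-≥ b x≤θ) (punchIn-<ᵇ x b a)) σ))

choose2 : ℕ → ℕ
choose2 zero    = 0
choose2 (suc k) = k + choose2 k

choose2-≥6 : ∀ n → 4 ≤ n → 6 ≤ choose2 n
choose2-≥6 (suc (suc (suc (suc n)))) (s≤s (s≤s (s≤s (s≤s _)))) =
  ℕ.+-mono-≤ (ℕ.m≤m+n 3 n) (ℕ.+-mono-≤ (ℕ.m≤m+n 2 n) (ℕ.≤-trans (ℕ.m≤m+n 1 n) (ℕ.m≤m+n (1 + n) _)))

bit-≤ᵇ-split : ∀ {θ x} b → θ ≤ x → bit ((θ ≤ᵇ b) ∧ (b <ᵇ x)) + bit (x ≤ᵇ b) ≡ bit (θ ≤ᵇ b)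
bit-≤ᵇ-split {x = x} b       z≤n     = bit-<ᵇ-+-≤ᵇ b x
bit-≤ᵇ-split         zero    (s≤s h) = refl
bit-≤ᵇ-split         (suc b) (s≤s h) = bit-≤ᵇ-split b h

bit-≤ᵇ-split-≢ : ∀ {θ v} b → θ ≤ v → (v ≡ᵇ b) ≡ false →
                 bit (v <ᵇ b) + bit ((θ ≤ᵇ b) ∧ (b <ᵇ v)) ≡ bit (θ ≤ᵇ b)
bit-≤ᵇ-split-≢ {v = v} b       z≤n     v≢b = bit-<ᵇ-+-<ᵇ v b v≢b
bit-≤ᵇ-split-≢         zero    (s≤s h) _   = refl
bit-≤ᵇ-split-≢         (suc b) (s≤s h) v≢b = bit-≤ᵇ-split-≢ b h v≢b

notIn⇒All : ∀ v l → notIn v l ≡ true → All (λ b → (v ≡ᵇ b) ≡ false) l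
notIn⇒All v []      _ = []
notIn⇒All v (y ∷ l) h with v ≡ᵇ y in v≢y
... | false = v≢y ∷ notIn⇒All v l h

ascAbove+descAbove : ∀ θ σ → distinct σ ≡ true → ascAbove θ σ + descAbove θ σ ≡ choose2 (count (θ ≤ᵇ_) σ)
ascAbove+descAbove θ []      _ = refl
ascAbove+descAbove θ (v ∷ l) d with notIn v l in v∉l | θ ≤ᵇ v in θ≤v
... | true | true = begin
  (count (v <ᵇ_) l + ascAbove θ l) + (count (λ b → (θ ≤ᵇ b) ∧ (b <ᵇ v)) l + descAbove θ l)
    ≡⟨ interchange (count (v <ᵇ_) l) _ _ _ ⟩
  (count (v <ᵇ_) l + count (λ b → (θ ≤ᵇ b) ∧ (b <ᵇ v)) l) + (ascAbove θ l + descAbove θ l)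
    ≡⟨ cong₂ _+_ (count-+ _ _ (θ ≤ᵇ_) (All.map (bit-≤ᵇ-split-≢ _ (≤ᵇ⇒≤ θ v θ≤v)) (notIn⇒All v l v∉l)))
                 (ascAbove+descAbove θ l d) ⟩
  count (θ ≤ᵇ_) l + choose2 (count (θ ≤ᵇ_) l) ∎
... | true | false = begin
  (count (λ _ → false) l + ascAbove θ l) + (count (λ b → (θ ≤ᵇ b) ∧ (b <ᵇ v)) l + descAbove θ l)
    ≡⟨ cong₂ (λ c c′ → (c + ascAbove θ l) + (c′ + descAbove θ l)) (count-false l) no-desc ⟩
  ascAbove θ l + descAbove θ l
    ≡⟨ ascAbove+descAbove θ l d ⟩
  choose2 (count (θ ≤ᵇ_) l) ∎
  where
  no-desc : count (λ b → (θ ≤ᵇ b) ∧ (b <ᵇ v)) l ≡ 0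
  no-desc = trans (count-cong (λ b → ≤ᵇ-∧-<ᵇ-≥ b (ℕ.<⇒≤ (≤ᵇ-false⇒> θ v θ≤v))) l) (count-false l)

Perm⇒count-≤ᵇ : ∀ {m σ} → Perm m σ → ∀ θ → count (θ ≤ᵇ_) σ ≡ m ∸ θ
Perm⇒count-≤ᵇ [] θ = sym (ℕ.0∸n≡0 θ)
Perm⇒count-≤ᵇ (cons {m} {σ} {x} x≤m r) θ with ℕ.≤-<-connex θ x
... | inj₁ θ≤x = begin
  bit (θ ≤ᵇ x) + count (θ ≤ᵇ_) (map (punchIn x) σ)
    ≡⟨ cong₂ _+_ (cong bit (≤⇒≤ᵇ θ≤x))
                 (trans (count-map (θ ≤ᵇ_) (punchIn x) σ) (count-cong (λ a → ≤ᵇ-punchIn-≤ a θ≤x) σ)) ⟩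
  suc (count (θ ≤ᵇ_) σ) ≡⟨ cong suc (Perm⇒count-≤ᵇ r θ) ⟩
  suc (m ∸ θ)           ≡⟨ ℕ.+-∸-assoc 1 (ℕ.≤-trans θ≤x x≤m) ⟨
  suc m ∸ θ             ∎
... | inj₂ x<θ = above θ x<θ
  where
  above : ∀ θ → x < θ → count (θ ≤ᵇ_) (prepend x σ) ≡ suc m ∸ θ
  above (suc θ) (s≤s x≤θ) = begin
    bit (suc θ ≤ᵇ x) + count (suc θ ≤ᵇ_) (map (punchIn x) σ)
      ≡⟨ cong₂ _+_ (cong bit (>⇒≤ᵇ-false (s≤s x≤θ)))
                   (trans (count-map (suc θ ≤ᵇ_) (punchIn x) σ) (count-cong (λ a → ≤ᵇ-punchIn-≥ a x≤θ) σ)) ⟩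
    count (θ ≤ᵇ_) σ ≡⟨ Perm⇒count-≤ᵇ r θ ⟩
    m ∸ θ           ∎

ascAbove+descAbove-top : ∀ {m σ} → Perm m σ → ascAbove m σ + descAbove m σ ≡ 0
ascAbove+descAbove-top {m} {σ} r =
  trans (ascAbove+descAbove m σ (Perm⇒distinct r)) (cong choose2 (trans (Perm⇒count-≤ᵇ r m) (ℕ.n∸n≡0 m)))

updateAsc : (ℕ → ℕ) → ℕ → ℕ → ℕ
updateAsc A t i = if i ≤ᵇ t then A i else A (i ∸ 1) + t

updateDesc : ℕ → (ℕ → ℕ) → ℕ → ℕ → ℕ
updateDesc μ D t i = if i ≤ᵇ t then D i else D (i ∸ 1) + ((i ∸ 1) ⊓ μ ∸ t)

module _ {m σ x} (r : Perm m σ) (x≤m : x ≤ m) (i : ℕ) where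

  private
    t = m ∸ x

    m∸i≡1+m∸[1+i] : suc i ≤ t → m ∸ i ≡ suc (m ∸ suc i)
    m∸i≡1+m∸[1+i] i<t = ℕ.+-∸-assoc 1 (ℕ.≤-trans i<t (ℕ.m∸n≤m m x))

    m∸i≤x : (suc i ≤ᵇ t) ≡ false → m ∸ i ≤ x
    m∸i≤x i≮t = m∸n≤o⇒m∸o≤n x≤m (ℕ.≤-pred (≤ᵇ-false⇒> (suc i) t i≮t))

  topAsc-prepend : topAsc (suc m) (prepend x σ) (suc i) ≡ updateAsc (topAsc m σ) t (suc i)
  topAsc-prepend with suc i ≤ᵇ t in i<t
  ... | true  = begin
    ascAbove (m ∸ i) (prepend x σ)           ≡⟨ cong (λ θ → ascAbove θ (prepend x σ)) (m∸i≡1+m∸[1+i] i<t′) ⟩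
    ascAbove (suc (m ∸ suc i)) (prepend x σ) ≡⟨ ascAbove-prepend-≥ σ (o<m∸n⇒n≤m∸suc[o] x≤m i<t′) ⟩
    ascAbove (m ∸ suc i) σ                   ∎
    where i<t′ = ≤ᵇ⇒≤ (suc i) t i<t
  ... | false = begin
    ascAbove (m ∸ i) (prepend x σ)           ≡⟨ ascAbove-prepend-≤ σ (m∸i≤x i<t) ⟩
    count (x ≤ᵇ_) σ + ascAbove (m ∸ i) σ     ≡⟨ cong (_+ ascAbove (m ∸ i) σ) (Perm⇒count-≤ᵇ r x) ⟩
    t + ascAbove (m ∸ i) σ                   ≡⟨ ℕ.+-comm t _ ⟩
    ascAbove (m ∸ i) σ + t                   ∎

  topDesc-prepend : topDesc (suc m) (prepend x σ) (suc i) ≡ updateDesc m (topDesc m σ) t (suc i)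
  topDesc-prepend with suc i ≤ᵇ t in i<t
  ... | true  = begin
    descAbove (m ∸ i) (prepend x σ)           ≡⟨ cong (λ θ → descAbove θ (prepend x σ)) (m∸i≡1+m∸[1+i] i<t′) ⟩
    descAbove (suc (m ∸ suc i)) (prepend x σ) ≡⟨ descAbove-prepend-≥ σ (o<m∸n⇒n≤m∸suc[o] x≤m i<t′) ⟩
    descAbove (m ∸ suc i) σ                   ∎
    where i<t′ = ≤ᵇ⇒≤ (suc i) t i<t
  ... | false = begin
    descAbove θ (prepend x σ)                 ≡⟨ descAbove-prepend-≤ σ (m∸i≤x i<t) ⟩
    between + descAbove θ σ                   ≡⟨ ℕ.+-comm between _ ⟩
    descAbove θ σ + between                   ≡⟨ cong (_+_ (descAbove θ σ)) between≡ ⟩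
    descAbove θ σ + (i ⊓ m ∸ t)               ∎
    where
    θ = m ∸ i
    between = count (λ b → (θ ≤ᵇ b) ∧ (b <ᵇ x)) σ
    split : between + count (x ≤ᵇ_) σ ≡ count (θ ≤ᵇ_) σ
    split = count-+ _ _ _ (universal (λ b → bit-≤ᵇ-split b (m∸i≤x i<t)) σ)
    between≡ : between ≡ i ⊓ m ∸ t
    between≡ = begin
      between                                     ≡⟨ ℕ.m+n∸n≡m between (count (x ≤ᵇ_) σ) ⟨
      between + count (x ≤ᵇ_) σ ∸ count (x ≤ᵇ_) σ
        ≡⟨ cong₂ _∸_ (trans split (Perm⇒count-≤ᵇ r θ)) (Perm⇒count-≤ᵇ r x) ⟩
      m ∸ θ ∸ t                                   ≡⟨ cong (_∸ t) (m∸[m∸n]≡n⊓m m i) ⟩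
      i ⊓ m ∸ t                                   ∎

updateAsc-cong : ∀ {A B : ℕ → ℕ} → (∀ j → j ≤ 3 → A j ≡ B j) →
                 ∀ t i → i ≤ 3 → updateAsc A t i ≡ updateAsc B t i
updateAsc-cong h t i i≤3 =
  cong₂ (λ u v → if i ≤ᵇ t then u else v + t) (h i i≤3) (h (i ∸ 1) (ℕ.≤-trans (ℕ.m∸n≤m i 1) i≤3))

updateDesc-cong : ∀ {D E : ℕ → ℕ} → (∀ j → j ≤ 3 → D j ≡ E j) → ∀ m t i → i ≤ 3 →
                  updateDesc m D t i ≡ updateDesc (m ⊓ 2) E t i
updateDesc-cong h m t i i≤3 = cong₂ (λ u v → if i ≤ᵇ t then u else v)
  (h i i≤3)
  (cong₂ (λ v w → v + (w ∸ t)) (h (i ∸ 1) (ℕ.≤-trans (ℕ.m∸n≤m i 1) i≤3))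
                                (n≤o⇒n⊓m≡n⊓[m⊓o] m (ℕ.∸-monoˡ-≤ 1 i≤3)))

-- Profiles

alive : ℕ → ℕ → Bool
alive a c = (a <ᵇ 3) ∧ (c <ᵇ 2)

alive⇒+≤3 : ∀ a c → alive a c ≡ true → a + c ≤ 3
alive⇒+≤3 a c h =
  ℕ.+-mono-≤ (ℕ.≤-pred (<ᵇ-true⇒< a 3 (∧-conicalˡ _ _ h))) (ℕ.≤-pred (<ᵇ-true⇒< c 2 (∧-conicalʳ _ _ h)))

alive-mono : ∀ k j {a c} → alive a c ≡ false → alive (k + a) (j + c) ≡ false
alive-mono k j {a} {c} a,c-dead with alive (k + a) (j + c) in h
... | false = refl
... | true  = trans (sym (cong₂ _∧_ (<ᵇ-+ˡ k a 3 (∧-conicalˡ _ _ h)) (<ᵇ-+ˡ j c 2 (∧-conicalʳ _ _ h)))) a,c-dead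

-- For a permutation σ of length m, live a c A₁ D₁ A₂ D₂ A₃ D₃ records a = #123 σ, c = #132 σ,
-- Aᵢ = ascAbove (m ∸ i) σ and Dᵢ = descAbove (m ∸ i) σ; dead means #123 σ ≥ 3 or #132 σ ≥ 2.
data Profile : Set where
  dead : Profile
  live : (a c A₁ D₁ A₂ D₂ A₃ D₃ : ℕ) → Profile

fromThresholds : (a c : ℕ) (A D : ℕ → ℕ) → Profile
fromThresholds a c A D = if alive a c then live a c (A 1) (D 1) (A 2) (D 2) (A 3) (D 3) else dead

profile : ℕ → List ℕ → Profile
profile m σ = fromThresholds (#123 σ) (#132 σ) (topAsc m σ) (topDesc m σ)

pick : ℕ → ℕ → ℕ → ℕ → ℕ
pick X₁ X₂ X₃ 1 = X₁
pick X₁ X₂ X₃ 2 = X₂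
pick X₁ X₂ X₃ 3 = X₃
pick X₁ X₂ X₃ _ = 0

-- Prepending x to a permutation of length m, for t = m ∸ x and μ = m ⊓ 2; see profile-prepend.
step : (μ t : ℕ) → Profile → Profile
step μ t dead = dead
step μ t (live a c A₁ D₁ A₂ D₂ A₃ D₃) =
  if 4 ≤ᵇ t then dead else fromThresholds (a + A t) (c + D t) (updateAsc A t) (updateDesc μ D t)
  where
  A D : ℕ → ℕ
  A = pick A₁ A₂ A₃
  D = pick D₁ D₂ D₃

fromThresholds-dead : ∀ a c A D → alive a c ≡ false → fromThresholds a c A D ≡ dead
fromThresholds-dead a c A D h rewrite h = refl

fromThresholds-live : ∀ a c A D → alive a c ≡ true → fromThresholds a c A D ≡ live a c (A 1) (D 1) (A 2) (D 2) (A 3) (D 3)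
fromThresholds-live a c A D h rewrite h = refl

fromThresholds-cong : ∀ {a a′ c c′} {A A′ D D′ : ℕ → ℕ} → a ≡ a′ → c ≡ c′ →
  (∀ i → i ≤ 2 → A (suc i) ≡ A′ (suc i)) → (∀ i → i ≤ 2 → D (suc i) ≡ D′ (suc i)) →
  fromThresholds a c A D ≡ fromThresholds a′ c′ A′ D′
fromThresholds-cong refl refl hA hD
  rewrite hA 0 z≤n | hA 1 (s≤s z≤n) | hA 2 (s≤s (s≤s z≤n)) | hD 0 z≤n | hD 1 (s≤s z≤n) | hD 2 (s≤s (s≤s z≤n)) = refl

step-far : ∀ μ t s → (4 ≤ᵇ t) ≡ true → step μ t s ≡ dead
step-far μ t dead                          _ = refl
step-far μ t (live a c A₁ D₁ A₂ D₂ A₃ D₃) h rewrite h = refl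

step-near : ∀ μ t a c A₁ D₁ A₂ D₂ A₃ D₃ → (4 ≤ᵇ t) ≡ false → step μ t (live a c A₁ D₁ A₂ D₂ A₃ D₃)
  ≡ fromThresholds (a + pick A₁ A₂ A₃ t) (c + pick D₁ D₂ D₃ t)
                   (updateAsc (pick A₁ A₂ A₃) t) (updateDesc μ (pick D₁ D₂ D₃) t)
step-near μ t a c A₁ D₁ A₂ D₂ A₃ D₃ h rewrite h = refl

pick-≡ : ∀ (X : ℕ → ℕ) → X 0 ≡ 0 → ∀ i → i ≤ 3 → pick (X 1) (X 2) (X 3) i ≡ X i
pick-≡ X X0 0 _ = sym X0
pick-≡ X X0 1 _ = refl
pick-≡ X X0 2 _ = refl
pick-≡ X X0 3 _ = refl
pick-≡ X X0 (suc (suc (suc (suc i)))) (s≤s (s≤s (s≤s ())))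

far-dead : ∀ {m σ x} a c → Perm m σ → x ≤ m → 4 ≤ m ∸ x → alive (ascAbove x σ + a) (descAbove x σ + c) ≡ false
far-dead {m} {σ} {x} a c r x≤m far with alive (ascAbove x σ + a) (descAbove x σ + c) in h
... | false = refl
... | true  = ⊥-elim (6≰3 (ℕ.≤-trans (choose2-≥6 _ far)
                              (subst (_≤ 3) pairs (ℕ.≤-trans grow (alive⇒+≤3 (ascAbove x σ + a) (descAbove x σ + c) h)))))
  where
  6≰3 : 6 ≤ 3 → ⊥
  6≰3 (s≤s (s≤s (s≤s ())))
  pairs : ascAbove x σ + descAbove x σ ≡ choose2 (m ∸ x)
  pairs = trans (ascAbove+descAbove x σ (Perm⇒distinct r)) (cong choose2 (Perm⇒count-≤ᵇ r x))
  grow : ascAbove x σ + descAbove x σ ≤ (ascAbove x σ + a) + (descAbove x σ + c)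
  grow = ℕ.+-mono-≤ (ℕ.m≤m+n (ascAbove x σ) a) (ℕ.m≤m+n (descAbove x σ) c)

profile-prepend-thresholds : ∀ {m σ x} → Perm m σ → x ≤ m → profile (suc m) (prepend x σ)
  ≡ fromThresholds (ascAbove x σ + #123 σ) (descAbove x σ + #132 σ) (updateAsc (topAsc m σ) (m ∸ x)) (updateDesc m (topDesc m σ) (m ∸ x))
profile-prepend-thresholds {m} {σ} {x} r x≤m =
  fromThresholds-cong {A = topAsc (suc m) (prepend x σ)} {updateAsc (topAsc m σ) (m ∸ x)}
                      {topDesc (suc m) (prepend x σ)} {updateDesc m (topDesc m σ) (m ∸ x)}
    (#123-prepend x σ) (#132-prepend x σ) (λ i _ → topAsc-prepend r x≤m i) (λ i _ → topDesc-prepend r x≤m i)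

step-profile : ∀ {m σ x} → Perm m σ → x ≤ m → step (m ⊓ 2) (m ∸ x) (profile m σ)
  ≡ fromThresholds (ascAbove x σ + #123 σ) (descAbove x σ + #132 σ) (updateAsc (topAsc m σ) (m ∸ x)) (updateDesc m (topDesc m σ) (m ∸ x))
step-profile {m} {σ} {x} r x≤m = bySurvival (alive (#123 σ) (#132 σ)) refl (4 ≤ᵇ t) refl
  where
  t = m ∸ x
  A D : ℕ → ℕ
  A = topAsc m σ
  D = topDesc m σ
  new : Profile
  new = fromThresholds (ascAbove x σ + #123 σ) (descAbove x σ + #132 σ) (updateAsc A t) (updateDesc m D t)
  A≡ : ∀ j → j ≤ 3 → A j ≡ pick (A 1) (A 2) (A 3) j
  A≡ j j≤3 = sym (pick-≡ A (ℕ.m+n≡0⇒m≡0 _ (ascAbove+descAbove-top r)) j j≤3)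
  D≡ : ∀ j → j ≤ 3 → D j ≡ pick (D 1) (D 2) (D 3) j
  D≡ j j≤3 = sym (pick-≡ D (ℕ.m+n≡0⇒n≡0 _ (ascAbove+descAbove-top r)) j j≤3)
  bySurvival : ∀ b → alive (#123 σ) (#132 σ) ≡ b → ∀ f → (4 ≤ᵇ t) ≡ f → step (m ⊓ 2) t (profile m σ) ≡ new
  bySurvival false σ-dead _ _ = begin
    step (m ⊓ 2) t (profile m σ) ≡⟨ cong (step (m ⊓ 2) t) (fromThresholds-dead (#123 σ) (#132 σ) A D σ-dead) ⟩
    dead                         ≡⟨ fromThresholds-dead _ _ (updateAsc A t) (updateDesc m D t)
                                                        (alive-mono (ascAbove x σ) (descAbove x σ) σ-dead) ⟨
    new                          ∎
  bySurvival true σ-alive true far = begin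
    step (m ⊓ 2) t (profile m σ) ≡⟨ step-far (m ⊓ 2) t (profile m σ) far ⟩
    dead                         ≡⟨ fromThresholds-dead _ _ (updateAsc A t) (updateDesc m D t)
                                                        (far-dead (#123 σ) (#132 σ) r x≤m (≤ᵇ⇒≤ 4 t far)) ⟨
    new                          ∎
  bySurvival true σ-alive false near = begin
    step (m ⊓ 2) t (profile m σ)
      ≡⟨ cong (step (m ⊓ 2) t) (fromThresholds-live (#123 σ) (#132 σ) A D σ-alive) ⟩
    step (m ⊓ 2) t (live (#123 σ) (#132 σ) (A 1) (D 1) (A 2) (D 2) (A 3) (D 3))
      ≡⟨ step-near (m ⊓ 2) t _ _ _ _ _ _ _ _ near ⟩
    fromThresholds (#123 σ + pick (A 1) (A 2) (A 3) t) (#132 σ + pick (D 1) (D 2) (D 3) t)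
                   (updateAsc (pick (A 1) (A 2) (A 3)) t) (updateDesc (m ⊓ 2) (pick (D 1) (D 2) (D 3)) t)
      ≡⟨ fromThresholds-cong {A = updateAsc A t} {updateAsc (pick (A 1) (A 2) (A 3)) t}
                             {updateDesc m D t} {updateDesc (m ⊓ 2) (pick (D 1) (D 2) (D 3)) t}
           (pairs-above-x ascAbove #123 {A} A≡) (pairs-above-x descAbove #132 {D} D≡)
           (λ i i≤2 → updateAsc-cong A≡ t (suc i) (s≤s i≤2))
           (λ i i≤2 → updateDesc-cong D≡ m t (suc i) (s≤s i≤2)) ⟨
    new ∎
    where
    t≤3 : t ≤ 3
    t≤3 = ℕ.≤-pred (≤ᵇ-false⇒> 4 t near)
    pairs-above-x : ∀ (pairs : ℕ → List ℕ → ℕ) (#pattern : List ℕ → ℕ) {X : ℕ → ℕ} →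
                    (∀ j → j ≤ 3 → pairs (m ∸ j) σ ≡ pick (X 1) (X 2) (X 3) j) →
                    pairs x σ + #pattern σ ≡ #pattern σ + pick (X 1) (X 2) (X 3) t
    pairs-above-x pairs #pattern {X} X≡ = begin
      pairs x σ + #pattern σ        ≡⟨ ℕ.+-comm (pairs x σ) (#pattern σ) ⟩
      #pattern σ + pairs x σ        ≡⟨ cong (λ y → #pattern σ + pairs y σ) (ℕ.m∸[m∸n]≡n x≤m) ⟨
      #pattern σ + pairs (m ∸ t) σ  ≡⟨ cong (_+_ (#pattern σ)) (X≡ t t≤3) ⟩
      #pattern σ + pick (X 1) (X 2) (X 3) t ∎

profile-prepend : ∀ {m σ x} → Perm m σ → x ≤ m → profile (suc m) (prepend x σ) ≡ step (m ⊓ 2) (m ∸ x) (profile m σ)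
profile-prepend r x≤m = trans (profile-prepend-thresholds r x≤m) (sym (step-profile r x≤m))

encode : Profile → List ℕ
encode dead                          = []
encode (live a c A₁ D₁ A₂ D₂ A₃ D₃) = a ∷ c ∷ A₁ ∷ D₁ ∷ A₂ ∷ D₂ ∷ A₃ ∷ D₃ ∷ []

encode-injective : ∀ {s s′} → encode s ≡ encode s′ → s ≡ s′
encode-injective {dead}                 {dead}                 _    = refl
encode-injective {live _ _ _ _ _ _ _ _} {live _ _ _ _ _ _ _ _} refl = refl

_≡ᴸ_ : List ℕ → List ℕ → Bool
[]       ≡ᴸ []       = true
(x ∷ xs) ≡ᴸ (y ∷ ys) = (x ≡ᵇ y) ∧ (xs ≡ᴸ ys)
_        ≡ᴸ _        = false

≡ᴸ⇒≡ : ∀ xs ys → (xs ≡ᴸ ys) ≡ true → xs ≡ ys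
≡ᴸ⇒≡ []       []       _ = refl
≡ᴸ⇒≡ (x ∷ xs) (y ∷ ys) h =
  cong₂ _∷_ (≡ᵇ-true⇒≡ x y (∧-conicalˡ _ _ h)) (≡ᴸ⇒≡ xs ys (∧-conicalʳ _ _ h))

infix 4 _==_ _∈ᵇ_

_==_ : Profile → Profile → Bool
s == s′ = encode s ≡ᴸ encode s′

==⇒≡ : ∀ s s′ → (s == s′) ≡ true → s ≡ s′
==⇒≡ s s′ h = encode-injective (≡ᴸ⇒≡ (encode s) (encode s′) h)

==-∧ : ∀ (g : Profile → Bool) s s′ → ((s == s′) ∧ g s) ≡ ((s == s′) ∧ g s′)
==-∧ g s s′ with s == s′ in s≡s′
... | true  = cong g (==⇒≡ s s′ s≡s′)
... | false = refl

_∈ᵇ_ : Profile → List Profile → Bool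
s ∈ᵇ []       = false
s ∈ᵇ (s′ ∷ S) = (s == s′) ∨ (s ∈ᵇ S)

allᵇ : (Profile → Bool) → List Profile → Bool
allᵇ p []      = true
allᵇ p (s ∷ S) = p s ∧ allᵇ p S

allᵇ-∈ᵇ : ∀ (p : Profile → Bool) S s → allᵇ p S ≡ true → (s ∈ᵇ S) ≡ true → p s ≡ true
allᵇ-∈ᵇ p (s′ ∷ S) s all-p s∈S with s == s′ in s≡s′
... | true  rewrite ==⇒≡ s s′ s≡s′ = ∧-conicalˡ _ _ all-p
... | false = allᵇ-∈ᵇ p S s (∧-conicalʳ _ _ all-p) s∈S

uniqueᵇ : List Profile → Bool
uniqueᵇ []      = true
uniqueᵇ (s ∷ S) = not (s ∈ᵇ S) ∧ uniqueᵇ S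

-- A₁ = D₁ = 0 always: a permutation of length m has only one value ≥ m ∸ 1.
thresholdPatterns : List (ℕ × ℕ × ℕ × ℕ)
thresholdPatterns =
    (0 , 0 , 0 , 0) ∷ (0 , 0 , 0 , 1) ∷ (0 , 0 , 1 , 0) ∷ (0 , 0 , 2 , 0)
  ∷ (0 , 1 , 0 , 1) ∷ (0 , 1 , 0 , 2) ∷ (0 , 1 , 0 , 3) ∷ (0 , 1 , 1 , 1)
  ∷ (0 , 1 , 1 , 2) ∷ (0 , 1 , 2 , 1) ∷ (1 , 0 , 1 , 0) ∷ (1 , 0 , 1 , 1)
  ∷ (1 , 0 , 1 , 2) ∷ (1 , 0 , 2 , 0) ∷ (1 , 0 , 2 , 1) ∷ (1 , 0 , 3 , 0)
  ∷ []

liveProfiles : List Profile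
liveProfiles = concatMap (λ a → concatMap (λ c → map (liveWith a c) thresholdPatterns) (upTo 2)) (upTo 3)
  where
  liveWith : ℕ → ℕ → ℕ × ℕ × ℕ × ℕ → Profile
  liveWith a c (A₂ , D₂ , A₃ , D₃) = live a c 0 0 A₂ D₂ A₃ D₃

profiles : List Profile
profiles = dead ∷ liveProfiles

Live : Profile → Set
Live dead                    = ⊥
Live (live _ _ _ _ _ _ _ _) = ⊤

live? : ∀ s → Dec (Live s)
live? dead                    = no (λ ())
live? (live _ _ _ _ _ _ _ _) = yes tt

liveProfiles-live : All Live liveProfiles
liveProfiles-live = from-yes (All.all? live? liveProfiles)

dead≢live : ∀ {s} → Live s → (dead == s) ≡ false
dead≢live {live _ _ _ _ _ _ _ _} _ = refl

live≢dead : ∀ {s} → Live s → (s == dead) ≡ false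
live≢dead {live _ _ _ _ _ _ _ _} _ = refl

step-pre-live : ∀ μ t {s s′} → Live s → (step μ t s′ == s) ≡ true → Live s′
step-pre-live μ t {live _ _ _ _ _ _ _ _} {live _ _ _ _ _ _ _ _} _ _ = tt

step-closed-finite : ∀ {μ} → μ < 3 → ∀ {t} → t < 4 → allᵇ (λ s → step μ t s ∈ᵇ profiles) profiles ≡ true
step-closed-finite =
  from-yes (ℕ.allUpTo? (λ μ → ℕ.allUpTo? (λ t → allᵇ (λ s → step μ t s ∈ᵇ profiles) profiles Bool.≟ true) 4) 3)

step-closed : ∀ μ t s → μ ≤ 2 → (s ∈ᵇ profiles) ≡ true → (step μ t s ∈ᵇ profiles) ≡ true
step-closed μ t s μ≤2 s∈ with 4 ≤ᵇ t in far
... | true  rewrite step-far μ t s far = refl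
... | false = allᵇ-∈ᵇ (λ s → step μ t s ∈ᵇ profiles) profiles s
                      (step-closed-finite (s≤s μ≤2) (≤ᵇ-false⇒> 4 t far)) s∈

profile-∈ᵇ : ∀ {m σ} → Perm m σ → (profile m σ ∈ᵇ profiles) ≡ true
profile-∈ᵇ []                       = refl
profile-∈ᵇ (cons {m} {σ} {x} x≤m r) =
  subst (λ s → (s ∈ᵇ profiles) ≡ true) (sym (profile-prepend r x≤m))
        (step-closed (m ⊓ 2) (m ∸ x) (profile m σ) (ℕ.m⊓n≤n m 2) (profile-∈ᵇ r))

sumWhere : (Profile → Bool) → (Profile → ℕ) → List Profile → ℕ
sumWhere p f []      = 0
sumWhere p f (s ∷ S) = (if p s then f s else 0) + sumWhere p f S

sumWhere-cong : ∀ {p : Profile → Bool} {f g : Profile → ℕ} S → (∀ s → p s ≡ true → f s ≡ g s) →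
                sumWhere p f S ≡ sumWhere p g S
sumWhere-cong                 []      h = refl
sumWhere-cong {p} {f} {g} (s ∷ S) h with p s in ps
... | true  = cong₂ _+_ (h s ps) (sumWhere-cong S h)
... | false = sumWhere-cong S h

sumWhere-+ : ∀ p (f g : Profile → ℕ) S → sumWhere p (λ s → f s + g s) S ≡ sumWhere p f S + sumWhere p g S
sumWhere-+ p f g []      = refl
sumWhere-+ p f g (s ∷ S) with p s
... | true  = trans (cong (_+_ (f s + g s)) (sumWhere-+ p f g S)) (interchange (f s) (g s) _ _)
... | false = sumWhere-+ p f g S

sumWhere-* : ∀ p c (f : Profile → ℕ) S → sumWhere p (λ s → c * f s) S ≡ c * sumWhere p f S
sumWhere-* p c f []      = sym (ℕ.*-zeroʳ c)
sumWhere-* p c f (s ∷ S) with p s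
... | true  = trans (cong (_+_ (c * f s)) (sumWhere-* p c f S)) (sym (ℕ.*-distribˡ-+ c (f s) _))
... | false = sumWhere-* p c f S

sumWhere-never : ∀ {p : Profile → Bool} f S → (∀ s → p s ≡ false) → sumWhere p f S ≡ 0
sumWhere-never f []      h = refl
sumWhere-never f (s ∷ S) h rewrite h s = sumWhere-never f S h

permCount-partition : ∀ m (f : List ℕ → Profile) (g : Profile → Bool) S → uniqueᵇ S ≡ true →
  permCount (λ σ → (f σ ∈ᵇ S) ∧ g (f σ)) m ≡ sumWhere g (λ s → permCount (λ σ → f σ == s) m) S
permCount-partition m f g []      _ = permCount-never m
permCount-partition m f g (s ∷ S) u = begin
  permCount (λ σ → ((f σ == s) ∨ (f σ ∈ᵇ S)) ∧ g (f σ)) m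
    ≡⟨ permCount-≗ m (λ σ → ∧-distribʳ-∨ (g (f σ)) (f σ == s) (f σ ∈ᵇ S)) ⟩
  permCount (λ σ → ((f σ == s) ∧ g (f σ)) ∨ ((f σ ∈ᵇ S) ∧ g (f σ))) m
    ≡⟨ permCount-∨ m _ _ (λ σ → disjoint (f σ)) ⟩
  permCount (λ σ → (f σ == s) ∧ g (f σ)) m + permCount (λ σ → (f σ ∈ᵇ S) ∧ g (f σ)) m
    ≡⟨ cong₂ _+_ (trans (permCount-≗ m (λ σ → ==-∧ g (f σ) s)) atS) (permCount-partition m f g S (∧-conicalʳ _ _ u)) ⟩
  (if g s then permCount (λ σ → f σ == s) m else 0) + sumWhere g (λ s → permCount (λ σ → f σ == s) m) S ∎
  where
  s∉S : (s ∈ᵇ S) ≡ false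
  s∉S = trans (sym (not-involutive _)) (cong not (∧-conicalˡ _ _ u))
  disjoint : ∀ s₀ → (((s₀ == s) ∧ g s₀) ∧ ((s₀ ∈ᵇ S) ∧ g s₀)) ≡ false
  disjoint s₀ with s₀ == s in s₀≡s
  ... | false = refl
  ... | true rewrite ==⇒≡ s₀ s s₀≡s | s∉S = ∧-zeroʳ (g s)
  atS : permCount (λ σ → (f σ == s) ∧ g s) m ≡ (if g s then permCount (λ σ → f σ == s) m else 0)
  atS with g s
  ... | true  = permCount-≗ m (λ σ → ∧-identityʳ (f σ == s))
  ... | false = trans (permCount-≗ m (λ σ → ∧-zeroʳ (f σ == s))) (permCount-never m)

-- Opaque, so that conversion checking never starts enumerating permutations.
opaque
  profileCount : ℕ → Profile → ℕ
  profileCount m s = permCount (λ σ → profile m σ == s) m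

  profileCount-def : ∀ m s → profileCount m s ≡ permCount (λ σ → profile m σ == s) m
  profileCount-def m s = refl

permCount-byProfile : ∀ m (g : Profile → Bool) →
  permCount (λ σ → (profile m σ ∈ᵇ profiles) ∧ g (profile m σ)) m ≡ sumWhere g (profileCount m) profiles
permCount-byProfile m g =
  trans (permCount-partition m (profile m) g profiles refl) (sumWhere-cong {g} profiles (λ s _ → sym (profileCount-def m s)))

profileCount-outside : ∀ m s → (s ∈ᵇ profiles) ≡ false → profileCount m s ≡ 0
profileCount-outside m s s∉ = trans (profileCount-def m s) (permCount-false m notProfile)
  where
  notProfile : ∀ {σ} → Perm m σ → (profile m σ == s) ≡ false
  notProfile {σ} r with profile m σ == s in e
  ... | false = refl
  ... | true  = trans (sym (subst (λ s′ → (s′ ∈ᵇ profiles) ≡ true) (==⇒≡ (profile m σ) s e) (profile-∈ᵇ r))) s∉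

profileCount-suc : ∀ m s → profileCount (suc m) s
  ≡ ∑< (suc m) (λ t → sumWhere (λ s′ → step (m ⊓ 2) t s′ == s) (profileCount m) profiles)
profileCount-suc m s = begin
  profileCount (suc m) s
    ≡⟨ profileCount-def (suc m) s ⟩
  permCount (λ σ → profile (suc m) σ == s) (suc m)
    ≡⟨ permCount-suc m (λ σ → profile (suc m) σ == s) ⟩
  ∑< (suc m) (λ x → permCount (λ σ → profile (suc m) (prepend x σ) == s) m)
    ≡⟨ ∑<-cong (suc m) (λ x x≤m → byStep x (ℕ.≤-pred x≤m)) ⟩
  ∑< (suc m) (λ x → F (m ∸ x))
    ≡⟨ ∑<-reverse (suc m) F ⟩
  ∑< (suc m) F ∎
  where
  F : ℕ → ℕ
  F t = sumWhere (λ s′ → step (m ⊓ 2) t s′ == s) (profileCount m) profiles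
  byStep : ∀ x → x ≤ m → permCount (λ σ → profile (suc m) (prepend x σ) == s) m ≡ F (m ∸ x)
  byStep x x≤m = begin
    permCount (λ σ → profile (suc m) (prepend x σ) == s) m
      ≡⟨ permCount-cong m (λ {σ} r → trans (cong (_== s) (profile-prepend r x≤m))
                                           (cong (_∧ (step (m ⊓ 2) (m ∸ x) (profile m σ) == s)) (sym (profile-∈ᵇ r)))) ⟩
    permCount (λ σ → (profile m σ ∈ᵇ profiles) ∧ (step (m ⊓ 2) (m ∸ x) (profile m σ) == s)) m
      ≡⟨ permCount-byProfile m (λ s′ → step (m ⊓ 2) (m ∸ x) s′ == s) ⟩
    F (m ∸ x) ∎

profileCount-suc-live : ∀ m s → Live s → profileCount (suc m) s
  ≡ ∑< (suc m ⊓ 4) (λ t → sumWhere (λ s′ → step (m ⊓ 2) t s′ == s) (profileCount m) liveProfiles)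
profileCount-suc-live m s live-s = begin
  profileCount (suc m) s     ≡⟨ profileCount-suc m s ⟩
  ∑< (suc m) F
    ≡⟨ ∑<-⊓ 4 (suc m) F (λ i → sumWhere-never (profileCount m) profiles (λ s′ → dead≢live live-s)) ⟩
  ∑< (suc m ⊓ 4) F
    ≡⟨ ∑<-cong (suc m ⊓ 4) (λ t _ → cong (λ b → (if b then profileCount m dead else 0) + G t) (dead≢live live-s)) ⟩
  ∑< (suc m ⊓ 4) G ∎
  where
  F G : ℕ → ℕ
  F t = sumWhere (λ s′ → step (m ⊓ 2) t s′ == s) (profileCount m) profiles
  G t = sumWhere (λ s′ → step (m ⊓ 2) t s′ == s) (profileCount m) liveProfiles

sumAligned : (Profile → Bool) → List Profile → List ℕ → ℕ
sumAligned p (s ∷ S) (c ∷ cs) = (if p s then c else 0) + sumAligned p S cs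
sumAligned p _       _        = 0

sumAligned-map : ∀ p (g : Profile → Profile) (f : Profile → ℕ) S → sumAligned p (map g S) (map f S) ≡ sumWhere (p ∘ g) f S
sumAligned-map p g f []      = refl
sumAligned-map p g f (s ∷ S) = cong (_+_ (if p (g s) then f s else 0)) (sumAligned-map p g f S)

successors : ℕ → List (List Profile)
successors m = applyUpTo (λ t → map (step (m ⊓ 2) t) liveProfiles) (suc m ⊓ 4)

-- The table of successors is an argument so that evaluation computes it only once per step.
countAfter : List (List Profile) → List ℕ → Profile → ℕ
countAfter table v s = sum (map (λ row → sumAligned (_== s) row v) table)

countsAfter : List (List Profile) → List ℕ → List ℕ
countsAfter table v = map (countAfter table v) liveProfiles

counts : ℕ → List ℕ
counts zero    = map (λ s → bit (profile 0 [] == s)) liveProfiles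
counts (suc m) = countsAfter (successors m) (counts m)

counts-correct : ∀ m → map (profileCount m) liveProfiles ≡ counts m
counts-correct zero    = List.map-cong (profileCount-def 0) liveProfiles
counts-correct (suc m) = begin
  map (profileCount (suc m)) liveProfiles
    ≡⟨ List.map-cong-local {f = profileCount (suc m)} {countAfter (successors m) v} {liveProfiles}
                           (All.map byTransfer liveProfiles-live) ⟩
  countsAfter (successors m) (map (profileCount m) liveProfiles)
    ≡⟨ cong (countsAfter (successors m)) {map (profileCount m) liveProfiles} {counts m} (counts-correct m) ⟩
  countsAfter (successors m) (counts m)                     ∎
  where
  v : List ℕ
  v = map (profileCount m) liveProfiles
  byTransfer : ∀ {s} → Live s → profileCount (suc m) s ≡ countAfter (successors m) v s
  byTransfer {s} live-s = begin
    profileCount (suc m) s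
      ≡⟨ profileCount-suc-live m s live-s ⟩
    ∑< (suc m ⊓ 4) (λ t → sumWhere (λ s′ → step (m ⊓ 2) t s′ == s) (profileCount m) liveProfiles)
      ≡⟨ ∑<-cong (suc m ⊓ 4) (λ t _ → sumAligned-map (_== s) (step (m ⊓ 2) t) (profileCount m) liveProfiles) ⟨
    ∑< (suc m ⊓ 4) (λ t → sumAligned (_== s) (map (step (m ⊓ 2) t) liveProfiles) v)
      ≡⟨ cong sum (List.map-applyUpTo (λ t → map (step (m ⊓ 2) t) liveProfiles) (λ row → sumAligned (_== s) row v)
                                      (suc m ⊓ 4)) ⟨
    countAfter (successors m) v s ∎

-- Linear recurrences

-- f (n + 4) − 8 f (n + 3) + 24 f (n + 2) − 32 f (n + 1) + 16 f n = 0, with the negative terms moved across.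
Annihilated : (ℕ → ℕ) → ℕ → Set
Annihilated f n = f (4 + n) + 24 * f (2 + n) + 16 * f n ≡ 8 * f (3 + n) + 32 * f (1 + n)

Annihilated-cong : ∀ {f g : ℕ → ℕ} n → (∀ k → f k ≡ g k) → Annihilated f n → Annihilated g n
Annihilated-cong {f} {g} n f≗g h = begin
  g (4 + n) + 24 * g (2 + n) + 16 * g n ≡⟨ cong₃ (f≗g (4 + n)) (f≗g (2 + n)) (f≗g n) ⟨
  f (4 + n) + 24 * f (2 + n) + 16 * f n ≡⟨ h ⟩
  8 * f (3 + n) + 32 * f (1 + n)        ≡⟨ cong₂ (λ x y → 8 * x + 32 * y) (f≗g (3 + n)) (f≗g (1 + n)) ⟩
  8 * g (3 + n) + 32 * g (1 + n)        ∎
  where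
  cong₃ : ∀ {x x′ y y′ z z′} → x ≡ x′ → y ≡ y′ → z ≡ z′ → x + 24 * y + 16 * z ≡ x′ + 24 * y′ + 16 * z′
  cong₃ refl refl refl = refl

record IsLinear {A : Set} (P : A → Set) (L : (A → ℕ) → ℕ) : Set where
  field
    additive    : ∀ f g → L (λ a → f a + g a) ≡ L f + L g
    homogeneous : ∀ c f → L (λ a → c * f a) ≡ c * L f
    local       : ∀ {f g} → (∀ a → P a → f a ≡ g a) → L f ≡ L g

module _ {A : Set} {P : A → Set} {L : (A → ℕ) → ℕ} (linear : IsLinear P L) where

  open IsLinear linear

  annihilated-linear : ∀ (v : ℕ → A → ℕ) n → (∀ a → P a → Annihilated (λ k → v k a) n) →
                       Annihilated (λ k → L (v k)) n
  annihilated-linear v n h = begin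
    L (v (4 + n)) + 24 * L (v (2 + n)) + 16 * L (v n)     ≡⟨ combine₃ (v (4 + n)) (v (2 + n)) (v n) ⟨
    L (λ a → v (4 + n) a + 24 * v (2 + n) a + 16 * v n a) ≡⟨ local h ⟩
    L (λ a → 8 * v (3 + n) a + 32 * v (1 + n) a)          ≡⟨ combine₂ (v (3 + n)) (v (1 + n)) ⟩
    8 * L (v (3 + n)) + 32 * L (v (1 + n))                ∎
    where
    combine₂ : ∀ f g → L (λ a → 8 * f a + 32 * g a) ≡ 8 * L f + 32 * L g
    combine₂ f g = trans (additive _ _) (cong₂ _+_ (homogeneous 8 f) (homogeneous 32 g))
    combine₃ : ∀ f g h → L (λ a → f a + 24 * g a + 16 * h a) ≡ L f + 24 * L g + 16 * L h
    combine₃ f g h = trans (additive _ _) (cong₂ _+_ (trans (additive _ _) (cong (_+_ (L f)) (homogeneous 24 g))) (homogeneous 16 h))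

annihilated-iterate : ∀ {A : Set} {P : A → Set} (T : (A → ℕ) → A → ℕ) → (∀ a → P a → IsLinear P (λ f → T f a)) →
  (v : ℕ → A → ℕ) → (∀ k a → P a → v (suc k) a ≡ T (v k) a) →
  (∀ a → P a → Annihilated (λ k → v k a) 0) → ∀ j a → P a → Annihilated (λ k → v k a) j
annihilated-iterate T linear v v-suc base zero    a pa = base a pa
annihilated-iterate T linear v v-suc base (suc j) a pa =
  Annihilated-cong j (λ k → sym (v-suc k a pa))
    (annihilated-linear (linear a pa) v j (annihilated-iterate T linear v v-suc base j))

sumWhere-linear : ∀ p S → IsLinear (λ s → p s ≡ true) (λ f → sumWhere p f S)
sumWhere-linear p S = record
  { additive    = λ f g → sumWhere-+ p f g S
  ; homogeneous = λ c f → sumWhere-* p c f S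
  ; local       = sumWhere-cong S
  }

transfer : (Profile → ℕ) → Profile → ℕ
transfer v s = ∑< 4 (λ t → sumWhere (λ s′ → step 2 t s′ == s) v liveProfiles)

transfer-linear : ∀ s → Live s → IsLinear Live (λ f → transfer f s)
transfer-linear s live-s = record
  { additive    = λ f g → trans (∑<-cong 4 (λ t _ → sumWhere-+ (into t) f g liveProfiles)) (∑<-+ 4 (F f) (F g))
  ; homogeneous = λ c f → trans (∑<-cong 4 (λ t _ → sumWhere-* (into t) c f liveProfiles)) (∑<-* 4 c (F f))
  ; local       = λ f≗g → ∑<-cong 4 (λ t _ → sumWhere-cong liveProfiles (λ s′ e → f≗g s′ (step-pre-live 2 t live-s e)))
  }
  where
  into : ℕ → Profile → Bool
  into t s′ = step 2 t s′ == s
  F : (Profile → ℕ) → ℕ → ℕ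
  F f t = sumWhere (into t) f liveProfiles

annihilatedᵇ : (a₀ a₁ a₂ a₃ a₄ : ℕ) → Bool
annihilatedᵇ a₀ a₁ a₂ a₃ a₄ = (a₄ + 24 * a₂ + 16 * a₀) ≡ᵇ (8 * a₃ + 32 * a₁)

allAnnihilatedᵇ : (v₀ v₁ v₂ v₃ v₄ : List ℕ) → Bool
allAnnihilatedᵇ (a₀ ∷ v₀) (a₁ ∷ v₁) (a₂ ∷ v₂) (a₃ ∷ v₃) (a₄ ∷ v₄) =
  annihilatedᵇ a₀ a₁ a₂ a₃ a₄ ∧ allAnnihilatedᵇ v₀ v₁ v₂ v₃ v₄
allAnnihilatedᵇ _          _          _          _          _          = true

allAnnihilatedᵇ-map : ∀ (v : ℕ → Profile → ℕ) S {v₀ v₁ v₂ v₃ v₄} →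
  map (v 0) S ≡ v₀ → map (v 1) S ≡ v₁ → map (v 2) S ≡ v₂ → map (v 3) S ≡ v₃ → map (v 4) S ≡ v₄ →
  allAnnihilatedᵇ v₀ v₁ v₂ v₃ v₄ ≡ true → ∀ s → (s ∈ᵇ S) ≡ true → Annihilated (λ k → v k s) 0
allAnnihilatedᵇ-map v S refl refl refl refl refl = onMaps S
  where
  onMaps : ∀ S → allAnnihilatedᵇ (map (v 0) S) (map (v 1) S) (map (v 2) S) (map (v 3) S) (map (v 4) S) ≡ true →
           ∀ s → (s ∈ᵇ S) ≡ true → Annihilated (λ k → v k s) 0
  onMaps (s′ ∷ S) h s s∈ with s == s′ in e
  ... | true  rewrite ==⇒≡ s s′ e = ≡ᵇ-true⇒≡ _ _ (∧-conicalˡ _ _ h)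
  ... | false = onMaps S (∧-conicalʳ _ _ h) s s∈

counts-annihilated : allAnnihilatedᵇ (counts 6) (counts 7) (counts 8) (counts 9) (counts 10) ≡ true
counts-annihilated = refl

profileCount-annihilated-base : ∀ s → Live s → Annihilated (λ k → profileCount (6 + k) s) 0
profileCount-annihilated-base s live-s = byMembership (s ∈ᵇ liveProfiles) refl
  where
  byMembership : ∀ b → (s ∈ᵇ liveProfiles) ≡ b → Annihilated (λ k → profileCount (6 + k) s) 0
  byMembership true  s∈ = allAnnihilatedᵇ-map (λ k → profileCount (6 + k)) liveProfiles
    (counts-correct 6) (counts-correct 7) (counts-correct 8) (counts-correct 9) (counts-correct 10) counts-annihilated s s∈
  byMembership false s∉ = Annihilated-cong 0 (λ k → sym (profileCount-outside (6 + k) s s∉′)) refl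
    where
    s∉′ : (s ∈ᵇ profiles) ≡ false
    s∉′ = trans (cong (_∨ (s ∈ᵇ liveProfiles)) (live≢dead live-s)) s∉

profileCount-annihilated : ∀ j s → Live s → Annihilated (λ k → profileCount (6 + k) s) j
profileCount-annihilated = annihilated-iterate transfer transfer-linear (λ k → profileCount (6 + k))
  (λ k s live-s → profileCount-suc-live (6 + k) s live-s) profileCount-annihilated-base

isTarget : Profile → Bool
isTarget dead                    = false
isTarget (live a c _ _ _ _ _ _) = (c ≡ᵇ 1) ∧ (a ≡ᵇ 2)

isTarget⇒Live : ∀ s → isTarget s ≡ true → Live s
isTarget⇒Live (live _ _ _ _ _ _ _ _) _ = tt

target⇒alive : ∀ a c → ((c ≡ᵇ 1) ∧ (a ≡ᵇ 2)) ≡ true → alive a c ≡ true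
target⇒alive a c h
  rewrite ≡ᵇ-true⇒≡ c 1 (∧-conicalˡ _ _ h) | ≡ᵇ-true⇒≡ a 2 (∧-conicalʳ (c ≡ᵇ 1) _ h) = refl

isTarget-fromThresholds : ∀ a c A D → isTarget (fromThresholds a c A D) ≡ ((c ≡ᵇ 1) ∧ (a ≡ᵇ 2))
isTarget-fromThresholds a c A D = byAlive (alive a c) refl
  where
  byAlive : ∀ b → alive a c ≡ b → isTarget (fromThresholds a c A D) ≡ ((c ≡ᵇ 1) ∧ (a ≡ᵇ 2))
  byAlive true  a,c-alive = cong isTarget (fromThresholds-live a c A D a,c-alive)
  byAlive false a,c-dead  = trans (cong isTarget (fromThresholds-dead a c A D a,c-dead)) (sym notTarget)
    where
    notTarget : ((c ≡ᵇ 1) ∧ (a ≡ᵇ 2)) ≡ false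
    notTarget with (c ≡ᵇ 1) ∧ (a ≡ᵇ 2) in h
    ... | false = refl
    ... | true  = trans (sym (target⇒alive a c h)) a,c-dead

b≡sumWhere : ∀ n → b n ≡ sumWhere isTarget (profileCount n) liveProfiles
b≡sumWhere n = begin
  b n
    ≡⟨ length-filterᵇ _ (allVecs n n) ⟩
  count (λ π → isPerm π ∧ (occ132 π ≡ᵇ 1) ∧ (occ123 π ≡ᵇ 2)) (allVecs n n)
    ≡⟨ count-cong onWords (allVecs n n) ⟩
  count ((λ w → distinct w ∧ isTargetWord w) ∘ word) (allVecs n n)
    ≡⟨ count-allVecs n n (λ w → distinct w ∧ isTargetWord w) ⟩
  permCount isTargetWord n
    ≡⟨ permCount-cong n viaProfile ⟩
  permCount (λ σ → (profile n σ ∈ᵇ profiles) ∧ isTarget (profile n σ)) n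
    ≡⟨ permCount-byProfile n isTarget ⟩
  sumWhere isTarget (profileCount n) profiles ∎
  where
  isTargetWord : List ℕ → Bool
  isTargetWord w = (#132 w ≡ᵇ 1) ∧ (#123 w ≡ᵇ 2)
  onWords : ∀ (π : Vec (Fin n) n) →
            (isPerm π ∧ (occ132 π ≡ᵇ 1) ∧ (occ123 π ≡ᵇ 2)) ≡ (distinct (word π) ∧ isTargetWord (word π))
  onWords π = cong₂ _∧_
    (trans (cong (_≡ᵇ 0) (sum-countᵇ-pairs _≡ᵇ_ g)) (pairCount-≡ᵇ-0 (word π)))
    (cong₂ _∧_ (cong (_≡ᵇ 1) (countTriples-map is132 g)) (cong (_≡ᵇ 2) (countTriples-map is123 g)))
    where
    g : Fin n → ℕ
    g i = toℕ (lookup π i)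
  viaProfile : ∀ {σ} → Perm n σ → isTargetWord σ ≡ ((profile n σ ∈ᵇ profiles) ∧ isTarget (profile n σ))
  viaProfile {σ} r =
    trans (sym (isTarget-fromThresholds (#123 σ) (#132 σ) (topAsc n σ) (topDesc n σ)))
          (cong (_∧ isTarget (profile n σ)) (sym (profile-∈ᵇ r)))

b-annihilated : ∀ j → Annihilated b (6 + j)
b-annihilated j = Annihilated-cong {λ k → sumWhere isTarget (profileCount (6 + k)) liveProfiles} {λ k → b (6 + k)} j
  (λ k → sym (b≡sumWhere (6 + k)))
  (annihilated-linear (sumWhere-linear isTarget liveProfiles) (λ k → profileCount (6 + k)) j
    (λ s target → profileCount-annihilated j s (isTarget⇒Live s target)))

b≡counts : ∀ n → b n ≡ sumAligned isTarget liveProfiles (counts n)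
b≡counts n = begin
  b n                                                        ≡⟨ b≡sumWhere n ⟩
  sumWhere isTarget (profileCount n) liveProfiles            ≡⟨ sumAligned-map isTarget (λ s → s) (profileCount n) liveProfiles ⟨
  sumAligned isTarget (map (λ s → s) liveProfiles) (map (profileCount n) liveProfiles)
    ≡⟨ cong (λ S → sumAligned isTarget S (map (profileCount n) liveProfiles)) (List.map-id liveProfiles) ⟩
  sumAligned isTarget liveProfiles (map (profileCount n) liveProfiles)
    ≡⟨ cong (sumAligned isTarget liveProfiles) {map (profileCount n) liveProfiles} {counts n} (counts-correct n) ⟩
  sumAligned isTarget liveProfiles (counts n)                ∎

initialValues : List ℤ
initialValues = + 0 ∷ + 0 ∷ + 0 ∷ + 0 ∷ + 1 ∷ + 4 ∷ + 14 ∷ + 47 ∷ + 152 ∷ + 472 ∷ []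

b-initial : ∀ {n} → n < 10 → + b n ≡ poly initialValues n
b-initial {n} n<10 = trans (cong (λ k → + k) (b≡counts n))
  (from-yes (ℕ.allUpTo? (λ k → + sumAligned isTarget liveProfiles (counts k) ℤP.≟ poly initialValues k) 10) n<10)

-- Power series

⊛-congˡ : ∀ {f f′ : Series} (g : Series) n → (∀ k → f k ≡ f′ k) → (f ⊛ g) n ≡ (f′ ⊛ g) n
⊛-congˡ g n f≗f′ = cong (foldr ℤ._+_ (+ 0)) (List.map-cong (λ k → cong (ℤ._* g (n ∸ k)) (f≗f′ k)) (upTo (suc n)))

⊛-congʳ : ∀ (f : Series) {g g′ : Series} n → (∀ k → g k ≡ g′ k) → (f ⊛ g) n ≡ (f ⊛ g′) n
⊛-congʳ f n g≗g′ = cong (foldr ℤ._+_ (+ 0)) (List.map-cong (λ k → cong (f k ℤ.*_) (g≗g′ (n ∸ k))) (upTo (suc n)))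

polyConv : List ℤ → Series → Series
polyConv []       g n       = + 0
polyConv (c ∷ cs) g zero    = c ℤ.* g 0
polyConv (c ∷ cs) g (suc n) = c ℤ.* g (suc n) ℤ.+ polyConv cs g n

poly-⊛ : ∀ cs g n → (poly cs ⊛ g) n ≡ polyConv cs g n
poly-⊛ []       g n       = vanish (upTo (suc n))
  where
  vanish : ∀ ks → foldr ℤ._+_ (+ 0) (map (λ k → poly [] k ℤ.* g (n ∸ k)) ks) ≡ + 0
  vanish []       = refl
  vanish (k ∷ ks) = cong (ℤ._+_ (+ 0)) (vanish ks)
poly-⊛ (c ∷ cs) g zero    = ℤP.+-identityʳ (c ℤ.* g 0)
poly-⊛ (c ∷ cs) g (suc n) = cong (ℤ._+_ (c ℤ.* g (suc n))) (begin
  foldr ℤ._+_ (+ 0) (map (λ k → poly (c ∷ cs) k ℤ.* g (suc n ∸ k)) (applyUpTo suc (suc n)))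
    ≡⟨ cong (foldr ℤ._+_ (+ 0)) (List.map-applyUpTo suc (λ k → poly (c ∷ cs) k ℤ.* g (suc n ∸ k)) (suc n)) ⟩
  foldr ℤ._+_ (+ 0) (applyUpTo (λ k → poly cs k ℤ.* g (n ∸ k)) (suc n))
    ≡⟨ cong (foldr ℤ._+_ (+ 0)) (List.map-applyUpTo (λ k → k) (λ k → poly cs k ℤ.* g (n ∸ k)) (suc n)) ⟨
  (poly cs ⊛ g) n
    ≡⟨ poly-⊛ cs g n ⟩
  polyConv cs g n ∎)

polyConv-cong : ∀ cs {g g′ : Series} n → (∀ k → k ≤ n → g k ≡ g′ k) → polyConv cs g n ≡ polyConv cs g′ n
polyConv-cong []       n       h = refl
polyConv-cong (c ∷ cs) zero    h = cong (c ℤ.*_) (h 0 z≤n)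
polyConv-cong (c ∷ cs) (suc n) h =
  cong₂ ℤ._+_ (cong (c ℤ.*_) (h (suc n) ℕ.≤-refl)) (polyConv-cong cs n (λ k k≤n → h k (ℕ.m≤n⇒m≤1+n k≤n)))

-- The coefficients of (1 − 2z) (p + c₀ z + c₁ z² + …) from z¹ on.
times1-2z : ℤ → List ℤ → List ℤ
times1-2z p []       = - (+ 2) ℤ.* p ∷ []
times1-2z p (c ∷ cs) = c ℤ.+ - (+ 2) ℤ.* p ∷ times1-2z c cs

poly-times1-2z : ∀ p cs k → poly (times1-2z p cs) k ≡ poly cs k ℤ.+ - (+ 2) ℤ.* poly (p ∷ cs) k
poly-times1-2z p []       zero    = sym (ℤP.+-identityˡ _)
poly-times1-2z p []       (suc k) = refl
poly-times1-2z p (c ∷ cs) zero    = refl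
poly-times1-2z p (c ∷ cs) (suc k) = poly-times1-2z c cs k

1-2z : Series
1-2z = poly (+ 1 ∷ - (+ 2) ∷ [])

1-2z-⊛-zero : ∀ g → (1-2z ⊛ g) 0 ≡ g 0
1-2z-⊛-zero g = trans (poly-⊛ (+ 1 ∷ - (+ 2) ∷ []) g 0) (ℤP.*-identityˡ (g 0))

1-2z-⊛-suc : ∀ g k → (1-2z ⊛ g) (suc k) ≡ g (suc k) ℤ.+ - (+ 2) ℤ.* g k
1-2z-⊛-suc g zero    = trans (poly-⊛ (+ 1 ∷ - (+ 2) ∷ []) g 1) (cong (ℤ._+ (- (+ 2) ℤ.* g 0)) (ℤP.*-identityˡ (g 1)))
1-2z-⊛-suc g (suc k) = trans (poly-⊛ (+ 1 ∷ - (+ 2) ∷ []) g (2 + k))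
                             (cong₂ ℤ._+_ (ℤP.*-identityˡ (g (2 + k))) (ℤP.+-identityʳ (- (+ 2) ℤ.* g (suc k))))

1-2z-⊛-poly : ∀ cs k → (1-2z ⊛ poly cs) k ≡ poly (times1-2z (+ 0) cs) k
1-2z-⊛-poly cs zero    = begin
  (1-2z ⊛ poly cs) 0                  ≡⟨ 1-2z-⊛-zero (poly cs) ⟩
  poly cs 0                           ≡⟨ ℤP.+-identityʳ (poly cs 0) ⟨
  poly cs 0 ℤ.+ - (+ 2) ℤ.* + 0       ≡⟨ poly-times1-2z (+ 0) cs 0 ⟨
  poly (times1-2z (+ 0) cs) 0         ∎
1-2z-⊛-poly cs (suc k) = trans (1-2z-⊛-suc (poly cs) k) (sym (poly-times1-2z (+ 0) cs (suc k)))

powersOf1-2z : ℕ → List ℤ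
powersOf1-2z zero    = + 1 ∷ []
powersOf1-2z (suc n) = times1-2z (+ 0) (powersOf1-2z n)

1-2z-^ˢ : ∀ n k → (1-2z ^ˢ n) k ≡ poly (powersOf1-2z n) k
1-2z-^ˢ zero    k = refl
1-2z-^ˢ (suc n) k = trans (⊛-congʳ 1-2z k (1-2z-^ˢ n)) (1-2z-⊛-poly (powersOf1-2z n) k)

polyConv-single : ∀ c g n → polyConv (c ∷ []) g n ≡ c ℤ.* g n
polyConv-single c g zero    = refl
polyConv-single c g (suc n) = ℤP.+-identityʳ (c ℤ.* g (suc n))

-- powersOf1-2z 4 evaluates to 1, −8, 24, −32, 16, which shapes the first line of the chain below.
powersOf1-2z4-annihilates : ∀ (a : ℕ → ℕ) n → Annihilated a n → polyConv (powersOf1-2z 4) (λ k → + a k) (4 + n) ≡ + 0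
powersOf1-2z4-annihilates a n h = begin
  + 1 ℤ.* x 4 ℤ.+ (- (+ 8) ℤ.* x 3 ℤ.+ (+ 24 ℤ.* x 2 ℤ.+ (- (+ 32) ℤ.* x 1 ℤ.+ polyConv (+ 16 ∷ []) (λ k → + a k) n)))
    ≡⟨ cong (λ y → + 1 ℤ.* x 4 ℤ.+ (- (+ 8) ℤ.* x 3 ℤ.+ (+ 24 ℤ.* x 2 ℤ.+ (- (+ 32) ℤ.* x 1 ℤ.+ y))))
            (polyConv-single (+ 16) (λ k → + a k) n) ⟩
  + 1 ℤ.* x 4 ℤ.+ (- (+ 8) ℤ.* x 3 ℤ.+ (+ 24 ℤ.* x 2 ℤ.+ (- (+ 32) ℤ.* x 1 ℤ.+ + 16 ℤ.* x 0)))
    ≡⟨ regroup (x 0) (x 1) (x 2) (x 3) (x 4) ⟩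
  (x 4 ℤ.+ + 24 ℤ.* x 2 ℤ.+ + 16 ℤ.* x 0) ℤ.- (+ 8 ℤ.* x 3 ℤ.+ + 32 ℤ.* x 1)
    ≡⟨ cong₂ ℤ._-_ positive negative ⟨
  + (a (4 + n) + 24 * a (2 + n) + 16 * a n) ℤ.- + (8 * a (3 + n) + 32 * a (1 + n))
    ≡⟨ cong (λ y → + y ℤ.- + (8 * a (3 + n) + 32 * a (1 + n))) h ⟩
  + (8 * a (3 + n) + 32 * a (1 + n)) ℤ.- + (8 * a (3 + n) + 32 * a (1 + n))
    ≡⟨ ℤP.+-inverseʳ (+ (8 * a (3 + n) + 32 * a (1 + n))) ⟩
  + 0 ∎
  where
  open +-*-Solver using (solve; _:+_; _:*_; _:-_; _:=_; con)
  x : ℕ → ℤ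
  x i = + a (i + n)
  regroup : ∀ x₀ x₁ x₂ x₃ x₄ →
    + 1 ℤ.* x₄ ℤ.+ (- (+ 8) ℤ.* x₃ ℤ.+ (+ 24 ℤ.* x₂ ℤ.+ (- (+ 32) ℤ.* x₁ ℤ.+ + 16 ℤ.* x₀)))
      ≡ (x₄ ℤ.+ + 24 ℤ.* x₂ ℤ.+ + 16 ℤ.* x₀) ℤ.- (+ 8 ℤ.* x₃ ℤ.+ + 32 ℤ.* x₁)
  regroup = solve 5 (λ x₀ x₁ x₂ x₃ x₄ →
    con (+ 1) :* x₄ :+ (con (- (+ 8)) :* x₃ :+ (con (+ 24) :* x₂ :+ (con (- (+ 32)) :* x₁ :+ con (+ 16) :* x₀)))
      := (x₄ :+ con (+ 24) :* x₂ :+ con (+ 16) :* x₀) :- (con (+ 8) :* x₃ :+ con (+ 32) :* x₁)) refl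
  positive : + (a (4 + n) + 24 * a (2 + n) + 16 * a n) ≡ x 4 ℤ.+ + 24 ℤ.* x 2 ℤ.+ + 16 ℤ.* x 0
  positive = trans (ℤP.pos-+ (a (4 + n) + 24 * a (2 + n)) (16 * a n))
    (cong₂ ℤ._+_ (trans (ℤP.pos-+ (a (4 + n)) (24 * a (2 + n))) (cong (ℤ._+_ (x 4)) (ℤP.pos-* 24 (a (2 + n)))))
                 (ℤP.pos-* 16 (a n)))
  negative : + (8 * a (3 + n) + 32 * a (1 + n)) ≡ + 8 ℤ.* x 3 ℤ.+ + 32 ℤ.* x 1
  negative = trans (ℤP.pos-+ (8 * a (3 + n)) (32 * a (1 + n))) (cong₂ ℤ._+_ (ℤP.pos-* 8 (a (3 + n))) (ℤP.pos-* 32 (a (1 + n))))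

z⁴ cubic : List ℤ
z⁴    = + 0 ∷ + 0 ∷ + 0 ∷ + 0 ∷ + 1 ∷ []
cubic = - (+ 1) ∷ + 4 ∷ - (+ 6) ∷ + 1 ∷ []

coefficients-agree-below-10 : ∀ {n} → n < 10 → polyConv (powersOf1-2z 4) (poly initialValues) n ≡ - polyConv z⁴ (poly cubic) n
coefficients-agree-below-10 =
  from-yes (ℕ.allUpTo? (λ n → polyConv (powersOf1-2z 4) (poly initialValues) n ℤP.≟ - polyConv z⁴ (poly cubic) n) 10)

coefficients-agree : ∀ n → polyConv (powersOf1-2z 4) B n ≡ - polyConv z⁴ (poly cubic) n
coefficients-agree n with ℕ.<-≤-connex n 10
... | inj₁ n<10 = trans (polyConv-cong (powersOf1-2z 4) n (λ k k≤n → b-initial (ℕ.≤-<-trans k≤n n<10)))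
                        (coefficients-agree-below-10 n<10)
... | inj₂ 10≤n = subst (λ k → polyConv (powersOf1-2z 4) B k ≡ - polyConv z⁴ (poly cubic) k) (ℕ.m+[n∸m]≡n 10≤n)
                        (powersOf1-2z4-annihilates b (6 + (n ∸ 10)) (b-annihilated (n ∸ 10)))

mainTheorem7 : (n : ℕ) →
    ((poly (+ 1 ∷ - (+ 2) ∷ []) ^ˢ 4) ⊛ B) n
      ≡ negˢ (poly (+ 0 ∷ + 0 ∷ + 0 ∷ + 0 ∷ + 1 ∷ []) ⊛ poly (- (+ 1) ∷ + 4 ∷ - (+ 6) ∷ + 1 ∷ [])) n
mainTheorem7 n = begin
  ((1-2z ^ˢ 4) ⊛ B) n                 ≡⟨ ⊛-congˡ B n (1-2z-^ˢ 4) ⟩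
  (poly (powersOf1-2z 4) ⊛ B) n       ≡⟨ poly-⊛ (powersOf1-2z 4) B n ⟩
  polyConv (powersOf1-2z 4) B n       ≡⟨ coefficients-agree n ⟩
  - polyConv z⁴ (poly cubic) n        ≡⟨ cong -_ (poly-⊛ z⁴ (poly cubic) n) ⟨
  negˢ (poly z⁴ ⊛ poly cubic) n       ∎
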